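{- Let $k\ge 1$ be an integer and let $m(k)=4$ if $k\equiv 0$ or $3 \pmod 4$, and $m(k)=3$ otherwise. Then for every integer $n\ge 1$, \[ \overline{p}_{k}(n)\equiv \begin{cases} -2k, & \text{if } n \text{ is an even square};\\ 2k, & \text{if } n \text{ is an odd square};\\ 2k(k+1), & \text{if } n \text{ is twice a square};\\ 0, & \text{otherwise} \end{cases} \pmod{2^{m(k)}}. \]
   Context: An overpartition of $n$ is a partition of $n$ in which the first occurrence of each distinct part may (or may not) be overlined. An overpartition $k$-tuple of $n$ is a $k$-tuple $(\omega_1,\dots,\omega_k)$ of overpartitions whose parts together sum to $n$. $\overline{p}_k(n)$ denotes the number of overpartition $k$-tuples of $n$, with $\overline{p}_k(0)=1$; equivalently $\sum_{n\ge0}\overline{p}_k(n)q^n=\big((-q;q)_\infty/(q;q)_\infty\big)^k=1/\varphi(-q)^k$, where $(a;q)_\infty=\prod_{n\ge0}(1-aq^n)$ and $\varphi(q)=\sum_{n=-\infty}^{\infty}q^{n^2}$. -}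

module Defs where

open import Data.Nat using (ℕ; zero; suc; _+_; _*_; _∸_; _^_; _≤ᵇ_; _%_)
open import Data.Bool using (if_then_else_)
open import Data.List using (List; map; upTo)
open import Data.Nat.ListAction using (sum)

-- ovp m n : number of overpartitions of n all of whose parts are ≤ m.
-- A part size j = suc m either does not occur, or occurs with some
-- multiplicity r+1 ≥ 1, in which case its first occurrence may or may
-- not be overlined (factor 2).
ovp : ℕ → ℕ → ℕ
ovp zero zero = 1
ovp zero (suc _) = 0
ovp (suc m) n =
  ovp m n +
  sum (map (λ r → if (suc r * suc m ≤ᵇ n)
                    then 2 * ovp m (n ∸ suc r * suc m)
                    else 0)
           (upTo n))

pbar : ℕ → ℕ
pbar n = ovp n n

-- p̄_k(n): number of overpartition k-tuples of n
-- (k-fold convolution of p̄; p̄_0(n) = [n = 0]).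
pbarK : ℕ → ℕ → ℕ
pbarK zero zero = 1
pbarK zero (suc _) = 0
pbarK (suc k) n = sum (map (λ i → pbar i * pbarK k (n ∸ i)) (upTo (suc n)))

mk-aux : ℕ → ℕ
mk-aux 0 = 4
mk-aux 3 = 4
mk-aux _ = 3

mk : ℕ → ℕ
mk k = mk-aux (k % 4)

module Submission where

-- We work in the ring ℤ[[q]] of formal power series (sequences ℕ → ℤ with
-- the Cauchy product, a commutative ring, so the ring solver applies) and
-- write φ(-q) = Σ_{n ∈ ℤ} (-1)ⁿ q^(n²) = 1 + 2A with A = Σ_{n ≥ 1} (-1)ⁿ q^(n²).
--  1. Gauss's identity P̄ φ(-q) = 1 for P̄ = Σ p̄(n) qⁿ.  Overpartitions with
--     parts ≤ r have generating function (-q;q)_r / (q;q)_r.  The q-binomial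
--     product formula (base q²) yields a finite Jacobi triple product identity;
--     for a = b = m it shows (q;q)_(2m) ≡ (-q;q)_(2m) φ(-q) below q^(m+1).
--  2. Hence P̄ᵏ = (1 + 2A)⁻ᵏ ≡ 1 - 2k A + 4 C(k+1,2) A² - 8 C(k+2,3) A³ (mod 16).
--  3. For n ≥ 1, the coefficient of qⁿ in A is ±1 at squares and 0 otherwise,
--     and in A² it is odd exactly at twice the squares.  The A³ term vanishes
--     modulo 2^m(k) (for m(k) = 4 both binomial coefficients are even), and
--     the theorem follows by reading off the four cases.

open import Defs
open import Data.Nat using (ℕ; _*_; _+_; _^_; _≥_)
open import Data.Integer using (ℤ; +_; -_; _-_)
open import Data.Integer.Divisibility using (_∣_)
open import Data.Product using (_×_; ∃)
open import Relation.Binary.PropositionalEquality using (_≡_)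
open import Relation.Nullary using (¬_)

open import Data.Nat using (zero; suc; _∸_; _≤_; _<_; z≤n; s≤s; _≤ᵇ_; _%_; ∣_-_∣)
import Data.Nat.Properties as ℕP
import Data.Nat.DivMod as ℕDM
open import Data.Nat.Divisibility using (divides) renaming (_∣_ to _∣ℕ_)
import Data.Nat.Divisibility as ℕD
open import Data.Nat.Induction using (<-rec)
open import Data.Nat.ListAction using (sum)
import Data.Nat.Tactic.RingSolver as ℕSolver
open import Data.Integer using (0ℤ; 1ℤ) renaming (_+_ to _+ℤ_; _*_ to _*ℤ_)
import Data.Integer.Properties as ℤP
import Data.Integer.Divisibility.Signed as Signed
open import Data.Integer.Tactic.RingSolver using (solve-∀)
open import Data.Bool using (true; false; if_then_else_; T)
open import Data.List using (map; upTo; applyUpTo)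
import Data.List.Properties as ListP
open import Data.Maybe using (Maybe; just; nothing)
open import Data.Product using (Σ; _,_)
open import Data.Sum using (_⊎_; inj₁; inj₂)
open import Data.Empty using (⊥-elim)
open import Function using (_∘_; id)
open import Level using (0ℓ)
open import Algebra.Bundles using (CommutativeRing)
open import Algebra.Structures using (IsCommutativeRing)
import Algebra.Solver.Ring.AlmostCommutativeRing as ACR
open import Algebra.Properties.Ring ℤP.+-*-ring using (+-cancelʳ)
open import Relation.Nullary using (Dec; yes; no)
open import Relation.Binary using (tri<; tri≈; tri>)
open import Relation.Binary.PropositionalEquality

Σ< : ℕ → (ℕ → ℤ) → ℤ
Σ< zero    f = 0ℤ
Σ< (suc n) f = f 0 +ℤ Σ< n (f ∘ suc)

Σ<-cong : ∀ n {f g : ℕ → ℤ} → (∀ i → i < n → f i ≡ g i) → Σ< n f ≡ Σ< n g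
Σ<-cong zero    eq = refl
Σ<-cong (suc n) eq =
  cong₂ _+ℤ_ (eq 0 (s≤s z≤n)) (Σ<-cong n (λ i i<n → eq (suc i) (s≤s i<n)))

Σ<-cong′ : ∀ n {f g : ℕ → ℤ} → (∀ i → f i ≡ g i) → Σ< n f ≡ Σ< n g
Σ<-cong′ n eq = Σ<-cong n (λ i _ → eq i)

Σ<-zero : ∀ n → Σ< n (λ _ → 0ℤ) ≡ 0ℤ
Σ<-zero zero    = refl
Σ<-zero (suc n) = cong (0ℤ +ℤ_) (Σ<-zero n)

Σ<-vanish : ∀ n (f : ℕ → ℤ) → (∀ i → f i ≡ 0ℤ) → Σ< n f ≡ 0ℤ
Σ<-vanish n f f≡0 = trans (Σ<-cong′ n f≡0) (Σ<-zero n)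

Σ<-+ : ∀ n (f g : ℕ → ℤ) → Σ< n (λ i → f i +ℤ g i) ≡ Σ< n f +ℤ Σ< n g
Σ<-+ zero    f g = refl
Σ<-+ (suc n) f g =
  trans (cong (f 0 +ℤ g 0 +ℤ_) (Σ<-+ n (f ∘ suc) (g ∘ suc)))
        (interchange (f 0) (g 0) (Σ< n (f ∘ suc)) (Σ< n (g ∘ suc)))
  where
  interchange : ∀ a b c d → (a +ℤ b) +ℤ (c +ℤ d) ≡ (a +ℤ c) +ℤ (b +ℤ d)
  interchange = solve-∀

Σ<-*ˡ : ∀ n c (f : ℕ → ℤ) → Σ< n (λ i → c *ℤ f i) ≡ c *ℤ Σ< n f
Σ<-*ˡ zero    c f = sym (ℤP.*-zeroʳ c)
Σ<-*ˡ (suc n) c f =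
  trans (cong (c *ℤ f 0 +ℤ_) (Σ<-*ˡ n c (f ∘ suc)))
        (sym (ℤP.*-distribˡ-+ c (f 0) (Σ< n (f ∘ suc))))

Σ<-*ʳ : ∀ n c (f : ℕ → ℤ) → Σ< n (λ i → f i *ℤ c) ≡ Σ< n f *ℤ c
Σ<-*ʳ n c f =
  trans (Σ<-cong′ n (λ i → ℤP.*-comm (f i) c))
        (trans (Σ<-*ˡ n c f) (ℤP.*-comm c (Σ< n f)))

Σ<-neg : ∀ n (f : ℕ → ℤ) → Σ< n (λ i → - f i) ≡ - Σ< n f
Σ<-neg zero    f = refl
Σ<-neg (suc n) f =
  trans (cong (- f 0 +ℤ_) (Σ<-neg n (f ∘ suc)))
        (sym (ℤP.neg-distrib-+ (f 0) (Σ< n (f ∘ suc))))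

Σ<-last : ∀ n (f : ℕ → ℤ) → Σ< (suc n) f ≡ Σ< n f +ℤ f n
Σ<-last zero    f = ℤP.+-comm (f 0) 0ℤ
Σ<-last (suc n) f =
  trans (cong (f 0 +ℤ_) (Σ<-last n (f ∘ suc))) (sym (ℤP.+-assoc (f 0) _ _))

Σ<-split : ∀ a b (f : ℕ → ℤ) → Σ< (a + b) f ≡ Σ< a f +ℤ Σ< b (λ i → f (a + i))
Σ<-split zero    b f = sym (ℤP.+-identityˡ _)
Σ<-split (suc a) b f =
  trans (cong (f 0 +ℤ_) (Σ<-split a b (f ∘ suc))) (sym (ℤP.+-assoc (f 0) _ _))

Σ<-reverse : ∀ n (f : ℕ → ℤ) → Σ< n f ≡ Σ< n (λ i → f (n ∸ suc i))
Σ<-reverse zero    f = refl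
Σ<-reverse (suc n) f =
  begin
    f 0 +ℤ Σ< n (f ∘ suc)
  ≡⟨ cong (f 0 +ℤ_) (Σ<-reverse n (f ∘ suc)) ⟩
    f 0 +ℤ Σ< n (λ i → f (suc (n ∸ suc i)))
  ≡⟨ ℤP.+-comm (f 0) _ ⟩
    Σ< n (λ i → f (suc (n ∸ suc i))) +ℤ f 0
  ≡⟨ cong₂ _+ℤ_ (Σ<-cong n (λ i i<n → cong f (sym (ℕP.+-∸-assoc 1 i<n))))
                (cong f (sym (ℕP.n∸n≡0 n))) ⟩
    Σ< n (λ i → f (n ∸ i)) +ℤ f (n ∸ n)
  ≡⟨ sym (Σ<-last n (λ i → f (n ∸ i))) ⟩
    Σ< (suc n) (λ i → f (n ∸ i))
  ∎
  where open ≡-Reasoning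

Σ<-truncate : ∀ n m (f : ℕ → ℤ) → n ≤ m → (∀ i → n ≤ i → f i ≡ 0ℤ) → Σ< m f ≡ Σ< n f
Σ<-truncate n m f n≤m tail≡0 =
  begin
    Σ< m f
  ≡⟨ cong (λ x → Σ< x f) (sym (ℕP.m+[n∸m]≡n n≤m)) ⟩
    Σ< (n + (m ∸ n)) f
  ≡⟨ Σ<-split n (m ∸ n) f ⟩
    Σ< n f +ℤ Σ< (m ∸ n) (λ i → f (n + i))
  ≡⟨ cong (Σ< n f +ℤ_) (Σ<-vanish (m ∸ n) _ (λ i → tail≡0 (n + i) (ℕP.m≤m+n n i))) ⟩
    Σ< n f +ℤ 0ℤ
  ≡⟨ ℤP.+-identityʳ _ ⟩
    Σ< n f
  ∎
  where open ≡-Reasoning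

Σ<-single : ∀ n (f : ℕ → ℤ) i₀ → i₀ < n → (∀ i → i ≢ i₀ → f i ≡ 0ℤ) → Σ< n f ≡ f i₀
Σ<-single (suc n) f zero _ others≡0 =
  trans (cong (f 0 +ℤ_) (Σ<-vanish n (f ∘ suc) (λ i → others≡0 (suc i) (λ ()))))
        (ℤP.+-identityʳ _)
Σ<-single (suc n) f (suc i₀) (s≤s i₀<n) others≡0 =
  trans (cong (_+ℤ Σ< n (f ∘ suc)) (others≡0 0 (λ ())))
        (trans (ℤP.+-identityˡ _)
               (Σ<-single n (f ∘ suc) i₀ i₀<n (λ i i≢i₀ → others≡0 (suc i) (i≢i₀ ∘ ℕP.suc-injective))))

Σ<-swap : ∀ n m (F : ℕ → ℕ → ℤ) → Σ< n (λ i → Σ< m (F i)) ≡ Σ< m (λ j → Σ< n (λ i → F i j))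
Σ<-swap zero    m F = sym (Σ<-zero m)
Σ<-swap (suc n) m F =
  trans (cong (Σ< m (F 0) +ℤ_) (Σ<-swap n m (F ∘ suc)))
        (sym (Σ<-+ m (F 0) (λ j → Σ< n (λ i → F (suc i) j))))

-- Fubini for a triangle: Σ_{j ≤ n} Σ_{l ≤ n-j} F j l = Σ_{t ≤ n} Σ_{j ≤ t} F j (t - j).
-- This is what makes the Cauchy product associative.
Σ<-triangle : ∀ n (F : ℕ → ℕ → ℤ) →
  Σ< (suc n) (λ j → Σ< (suc (n ∸ j)) (F j)) ≡ Σ< (suc n) (λ t → Σ< (suc t) (λ j → F j (t ∸ j)))
Σ<-triangle zero    F = refl
Σ<-triangle (suc n) F =
  begin
    Σ< (suc (suc n)) (λ j → Σ< (suc (suc n ∸ j)) (F j))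
  ≡⟨ Σ<-last (suc n) (λ j → Σ< (suc (suc n ∸ j)) (F j)) ⟩
    Σ< (suc n) (λ j → Σ< (suc (suc n ∸ j)) (F j)) +ℤ Σ< (suc (suc n ∸ suc n)) (F (suc n))
  ≡⟨ cong₂ _+ℤ_ (Σ<-cong (suc n) (λ j j≤n → peelRow j (ℕP.≤-pred j≤n)))
                (cong (λ x → Σ< (suc x) (F (suc n))) (ℕP.n∸n≡0 (suc n))) ⟩
    Σ< (suc n) (λ j → Σ< (suc (n ∸ j)) (F j) +ℤ F j (suc n ∸ j)) +ℤ (F (suc n) 0 +ℤ 0ℤ)
  ≡⟨ cong (_+ℤ (F (suc n) 0 +ℤ 0ℤ)) (Σ<-+ (suc n) (λ j → Σ< (suc (n ∸ j)) (F j)) (λ j → F j (suc n ∸ j))) ⟩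
    (Σ< (suc n) (λ j → Σ< (suc (n ∸ j)) (F j)) +ℤ Diagonal) +ℤ (F (suc n) 0 +ℤ 0ℤ)
  ≡⟨ cong (λ x → (x +ℤ Diagonal) +ℤ (F (suc n) 0 +ℤ 0ℤ)) (Σ<-triangle n F) ⟩
    (Triangle +ℤ Diagonal) +ℤ (F (suc n) 0 +ℤ 0ℤ)
  ≡⟨ regroup Triangle Diagonal (F (suc n) 0) ⟩
    Triangle +ℤ (Diagonal +ℤ F (suc n) 0)
  ≡⟨ cong (λ x → Triangle +ℤ (Diagonal +ℤ F (suc n) x)) (sym (ℕP.n∸n≡0 n)) ⟩
    Triangle +ℤ (Diagonal +ℤ F (suc n) (suc n ∸ suc n))
  ≡⟨ cong (Triangle +ℤ_) (sym (Σ<-last (suc n) (λ j → F j (suc n ∸ j)))) ⟩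
    Triangle +ℤ Σ< (suc (suc n)) (λ j → F j (suc n ∸ j))
  ≡⟨ sym (Σ<-last (suc n) (λ t → Σ< (suc t) (λ j → F j (t ∸ j)))) ⟩
    Σ< (suc (suc n)) (λ t → Σ< (suc t) (λ j → F j (t ∸ j)))
  ∎
  where
  open ≡-Reasoning
  Triangle = Σ< (suc n) (λ t → Σ< (suc t) (λ j → F j (t ∸ j)))
  Diagonal = Σ< (suc n) (λ j → F j (suc n ∸ j))
  peelRow : ∀ j → j ≤ n → Σ< (suc (suc n ∸ j)) (F j) ≡ Σ< (suc (n ∸ j)) (F j) +ℤ F j (suc n ∸ j)
  peelRow j j≤n rewrite ℕP.+-∸-assoc 1 j≤n = Σ<-last (suc (n ∸ j)) (F j)
  regroup : ∀ a b c → (a +ℤ b) +ℤ (c +ℤ 0ℤ) ≡ a +ℤ (b +ℤ c)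
  regroup = solve-∀

sum-upTo : ∀ n (g : ℕ → ℕ) → + sum (map g (upTo n)) ≡ Σ< n (λ r → + g r)
sum-upTo n g = trans (cong (λ l → + sum l) (ListP.map-applyUpTo id g n)) (go n g)
  where
  go : ∀ n (g : ℕ → ℕ) → + sum (applyUpTo g n) ≡ Σ< n (λ r → + g r)
  go zero    g = refl
  go (suc n) g = trans (ℤP.pos-+ (g 0) _) (cong (+ g 0 +ℤ_) (go n (g ∘ suc)))

Series : Set
Series = ℕ → ℤ

-- Coefficientwise equality (a record, so that both sides can be inferred).
infix 4 _≋_
record _≋_ (f g : Series) : Set where
  constructor pt
  field at : ∀ n → f n ≡ g n
open _≋_

infixl 6 _⊕_
infixl 7 _⊛_
infix  8 ⊝_

_⊕_ : Series → Series → Series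
(f ⊕ g) n = f n +ℤ g n

⊝_ : Series → Series
(⊝ f) n = - f n

𝟘 : Series
𝟘 _ = 0ℤ

const : ℤ → Series
const c zero    = c
const c (suc _) = 0ℤ

𝟙 : Series
𝟙 = const 1ℤ

_⊛_ : Series → Series → Series
(f ⊛ g) n = Σ< (suc n) (λ i → f i *ℤ g (n ∸ i))

≋-refl : ∀ {f} → f ≋ f
≋-refl = pt (λ _ → refl)

≋-reflexive : ∀ {f g} → f ≡ g → f ≋ g
≋-reflexive refl = ≋-refl

≋-sym : ∀ {f g} → f ≋ g → g ≋ f
≋-sym f≋g = pt (λ n → sym (at f≋g n))

≋-trans : ∀ {f g h} → f ≋ g → g ≋ h → f ≋ h
≋-trans f≋g g≋h = pt (λ n → trans (at f≋g n) (at g≋h n))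

⊕-cong : ∀ {f f′ g g′} → f ≋ f′ → g ≋ g′ → f ⊕ g ≋ f′ ⊕ g′
⊕-cong p q = pt (λ n → cong₂ _+ℤ_ (at p n) (at q n))

⊝-cong : ∀ {f f′} → f ≋ f′ → ⊝ f ≋ ⊝ f′
⊝-cong p = pt (λ n → cong -_ (at p n))

⊛-cong : ∀ {f f′ g g′} → f ≋ f′ → g ≋ g′ → f ⊛ g ≋ f′ ⊛ g′
⊛-cong p q = pt (λ n → Σ<-cong′ (suc n) (λ i → cong₂ _*ℤ_ (at p i) (at q (n ∸ i))))

⊛-comm : ∀ f g → f ⊛ g ≋ g ⊛ f
⊛-comm f g = pt λ n →
  trans (Σ<-reverse (suc n) (λ i → f i *ℤ g (n ∸ i)))
        (Σ<-cong (suc n) (λ i i≤n →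
          trans (cong (λ x → f (n ∸ i) *ℤ g x) (ℕP.m∸[m∸n]≡n (ℕP.≤-pred i≤n)))
                (ℤP.*-comm (f (n ∸ i)) (g i))))

⊛-assoc : ∀ f g h → (f ⊛ g) ⊛ h ≋ f ⊛ (g ⊛ h)
⊛-assoc f g h = pt λ n →
  begin
    Σ< (suc n) (λ t → Σ< (suc t) (λ j → f j *ℤ g (t ∸ j)) *ℤ h (n ∸ t))
  ≡⟨ Σ<-cong′ (suc n) (λ t → sym (Σ<-*ʳ (suc t) (h (n ∸ t)) (λ j → f j *ℤ g (t ∸ j)))) ⟩
    Σ< (suc n) (λ t → Σ< (suc t) (λ j → f j *ℤ g (t ∸ j) *ℤ h (n ∸ t)))
  ≡⟨ Σ<-cong′ (suc n) (λ t → Σ<-cong (suc t) (λ j j≤t → reassociate n t j (ℕP.≤-pred j≤t))) ⟩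
    Σ< (suc n) (λ t → Σ< (suc t) (λ j → f j *ℤ (g (t ∸ j) *ℤ h (n ∸ j ∸ (t ∸ j)))))
  ≡⟨ sym (Σ<-triangle n (λ j l → f j *ℤ (g l *ℤ h (n ∸ j ∸ l)))) ⟩
    Σ< (suc n) (λ j → Σ< (suc (n ∸ j)) (λ l → f j *ℤ (g l *ℤ h (n ∸ j ∸ l))))
  ≡⟨ Σ<-cong′ (suc n) (λ j → Σ<-*ˡ (suc (n ∸ j)) (f j) (λ l → g l *ℤ h (n ∸ j ∸ l))) ⟩
    Σ< (suc n) (λ j → f j *ℤ Σ< (suc (n ∸ j)) (λ l → g l *ℤ h (n ∸ j ∸ l)))
  ∎
  where
  open ≡-Reasoning
  reassociate : ∀ n t j → j ≤ t → f j *ℤ g (t ∸ j) *ℤ h (n ∸ t) ≡ f j *ℤ (g (t ∸ j) *ℤ h (n ∸ j ∸ (t ∸ j)))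
  reassociate n t j j≤t =
    trans (ℤP.*-assoc (f j) _ _)
          (cong (λ x → f j *ℤ (g (t ∸ j) *ℤ h x))
                (sym (trans (ℕP.∸-+-assoc n j (t ∸ j)) (cong (n ∸_) (ℕP.m+[n∸m]≡n j≤t)))))

⊛-distribˡ : ∀ f g h → f ⊛ (g ⊕ h) ≋ f ⊛ g ⊕ f ⊛ h
⊛-distribˡ f g h = pt λ n →
  trans (Σ<-cong′ (suc n) (λ i → ℤP.*-distribˡ-+ (f i) (g (n ∸ i)) (h (n ∸ i))))
        (Σ<-+ (suc n) (λ i → f i *ℤ g (n ∸ i)) (λ i → f i *ℤ h (n ∸ i)))

⊛-distribʳ : ∀ f g h → (g ⊕ h) ⊛ f ≋ g ⊛ f ⊕ h ⊛ f
⊛-distribʳ f g h = pt λ n →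
  trans (Σ<-cong′ (suc n) (λ i → ℤP.*-distribʳ-+ (f (n ∸ i)) (g i) (h i)))
        (Σ<-+ (suc n) (λ i → g i *ℤ f (n ∸ i)) (λ i → h i *ℤ f (n ∸ i)))

const-⊛ : ∀ c f n → (const c ⊛ f) n ≡ c *ℤ f n
const-⊛ c f n =
  trans (cong (c *ℤ f n +ℤ_) (Σ<-vanish n _ (λ i → ℤP.*-zeroˡ (f (n ∸ suc i)))))
        (ℤP.+-identityʳ _)

⊛-identityˡ : ∀ f → 𝟙 ⊛ f ≋ f
⊛-identityˡ f = pt (λ n → trans (const-⊛ 1ℤ f n) (ℤP.*-identityˡ (f n)))

⊛-identityʳ : ∀ f → f ⊛ 𝟙 ≋ f
⊛-identityʳ f = ≋-trans (⊛-comm f 𝟙) (⊛-identityˡ f)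

⊛-zeroʳ : ∀ f → f ⊛ 𝟘 ≋ 𝟘
⊛-zeroʳ f = pt (λ n → Σ<-vanish (suc n) _ (λ i → ℤP.*-zeroʳ (f i)))

⊛-at-0 : ∀ f g → (f ⊛ g) 0 ≡ f 0 *ℤ g 0
⊛-at-0 f g = ℤP.+-identityʳ _

const-neg : ∀ c → const (- c) ≋ ⊝ const c
const-neg c = pt λ { zero → refl ; (suc _) → refl }

const-cong : ∀ {a b} → a ≡ b → const a ≋ const b
const-cong refl = ≋-refl

series-isCommutativeRing : IsCommutativeRing _≋_ _⊕_ _⊛_ ⊝_ 𝟘 𝟙
series-isCommutativeRing = record
  { isRing = record
    { +-isAbelianGroup = record
      { isGroup = record
        { isMonoid = record
          { isSemigroup = record
            { isMagma = record
              { isEquivalence = record { refl = ≋-refl ; sym = ≋-sym ; trans = ≋-trans }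
              ; ∙-cong = ⊕-cong }
            ; assoc = λ f g h → pt (λ n → ℤP.+-assoc (f n) (g n) (h n)) }
          ; identity = (λ f → pt (λ n → ℤP.+-identityˡ (f n))) , (λ f → pt (λ n → ℤP.+-identityʳ (f n))) }
        ; inverse = (λ f → pt (λ n → ℤP.+-inverseˡ (f n))) , (λ f → pt (λ n → ℤP.+-inverseʳ (f n)))
        ; ⁻¹-cong = ⊝-cong }
      ; comm = λ f g → pt (λ n → ℤP.+-comm (f n) (g n)) }
    ; *-cong = ⊛-cong
    ; *-assoc = ⊛-assoc
    ; *-identity = ⊛-identityˡ , ⊛-identityʳ
    ; distrib = ⊛-distribˡ , ⊛-distribʳ }
  ; *-comm = ⊛-comm }

seriesRing : CommutativeRing 0ℓ 0ℓ
seriesRing = record { isCommutativeRing = series-isCommutativeRing }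

-- The constants form a copy of ℤ inside the series ring; this lets the
-- ring solver handle integer coefficients.
const-homomorphism : ACR._-Raw-AlmostCommutative⟶_
  (CommutativeRing.rawRing ℤP.+-*-commutativeRing) (ACR.fromCommutativeRing seriesRing)
const-homomorphism = record
  { ⟦_⟧    = const
  ; +-homo = λ a b → pt λ { zero → refl ; (suc _) → refl }
  ; *-homo = λ a b → ≋-sym (pt λ n → trans (const-⊛ a (const b) n) (times-const a b n))
  ; -‿homo = const-neg
  ; 0-homo = pt λ { zero → refl ; (suc _) → refl }
  ; 1-homo = ≋-refl }
  where
  times-const : ∀ a b n → a *ℤ const b n ≡ const (a *ℤ b) n
  times-const a b zero    = refl
  times-const a b (suc n) = ℤP.*-zeroʳ a

const-equal? : ∀ a b → Maybe (const a ≋ const b)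
const-equal? a b with a Data.Integer.≟ b
... | yes refl = just ≋-refl
... | no _     = nothing

open import Algebra.Solver.Ring
  (CommutativeRing.rawRing ℤP.+-*-commutativeRing) (ACR.fromCommutativeRing seriesRing)
  const-homomorphism const-equal?
  using (solve; _:=_; con; _:+_; _:*_; :-_; _:-_; Polynomial)

open import Relation.Binary.Reasoning.Setoid (CommutativeRing.setoid seriesRing)
  using () renaming (begin_ to begin≋_; _∎ to _∎≋; step-≈-⟩ to step-≋-⟩)

-- shift e f = qᵉ · f, computed by moving the coefficients.
shift : ℕ → Series → Series
shift zero    f         = f
shift (suc e) f zero    = 0ℤ
shift (suc e) f (suc n) = shift e f n

q^_ : ℕ → Series
q^ e = shift e 𝟙

shift-below : ∀ e f n → n < e → shift e f n ≡ 0ℤ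
shift-below (suc e) f zero    _         = refl
shift-below (suc e) f (suc n) (s≤s n<e) = shift-below e f n n<e

shift-above : ∀ e f p → shift e f (e + p) ≡ f p
shift-above zero    f p = refl
shift-above (suc e) f p = shift-above e f p

q^-⊛ : ∀ e f → q^ e ⊛ f ≋ shift e f
q^-⊛ zero    f = ⊛-identityˡ f
q^-⊛ (suc e) f = pt λ
  { zero    → refl
  ; (suc n) → trans (cong (_+ℤ Σ< (suc n) (λ i → (q^ suc e) (suc i) *ℤ f (n ∸ i)))
                          (ℤP.*-zeroˡ (f (suc n))))
                    (trans (ℤP.+-identityˡ _) (at (q^-⊛ e f) n)) }

q^-cong : ∀ {a b} → a ≡ b → q^ a ≋ q^ b
q^-cong refl = ≋-refl

q^-+ : ∀ a b → q^ (a + b) ≋ q^ a ⊛ q^ b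
q^-+ a b = ≋-sym (≋-trans (q^-⊛ a (q^ b)) (pt (shift-shift a)))
  where
  shift-shift : ∀ a n → shift a (q^ b) n ≡ (q^ (a + b)) n
  shift-shift zero    n       = refl
  shift-shift (suc a) zero    = refl
  shift-shift (suc a) (suc n) = shift-shift a n

q^-diagonal : ∀ n → (q^ n) n ≡ 1ℤ
q^-diagonal zero    = refl
q^-diagonal (suc n) = q^-diagonal n

q^-offDiagonal : ∀ e n → e ≢ n → (q^ e) n ≡ 0ℤ
q^-offDiagonal zero    zero    e≢n = ⊥-elim (e≢n refl)
q^-offDiagonal zero    (suc n) _   = refl
q^-offDiagonal (suc e) zero    _   = refl
q^-offDiagonal (suc e) (suc n) e≢n = q^-offDiagonal e n (e≢n ∘ cong suc)

ΣS : ℕ → (ℕ → Series) → Series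
ΣS n h k = Σ< n (λ j → h j k)

ΣS-cong : ∀ n {h h′ : ℕ → Series} → (∀ j → j < n → h j ≋ h′ j) → ΣS n h ≋ ΣS n h′
ΣS-cong n eq = pt (λ k → Σ<-cong n (λ j j<n → at (eq j j<n) k))

ΣS-⊕ : ∀ n (h g : ℕ → Series) → ΣS n (λ j → h j ⊕ g j) ≋ ΣS n h ⊕ ΣS n g
ΣS-⊕ n h g = pt (λ k → Σ<-+ n (λ j → h j k) (λ j → g j k))

ΣS-⊝ : ∀ n (h : ℕ → Series) → ΣS n (λ j → ⊝ h j) ≋ ⊝ ΣS n h
ΣS-⊝ n h = pt (λ k → Σ<-neg n (λ j → h j k))

ΣS-⊛ : ∀ n f (h : ℕ → Series) → f ⊛ ΣS n h ≋ ΣS n (λ j → f ⊛ h j)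
ΣS-⊛ n f h = pt λ k →
  trans (Σ<-cong′ (suc k) (λ i → sym (Σ<-*ˡ n (f i) (λ j → h j (k ∸ i)))))
        (Σ<-swap (suc k) n (λ i j → f i *ℤ h j (k ∸ i)))

ΣS-truncate : ∀ n m (h : ℕ → Series) → n ≤ m → (∀ j → n ≤ j → h j ≋ 𝟘) → ΣS m h ≋ ΣS n h
ΣS-truncate n m h n≤m tail≋0 = pt (λ k → Σ<-truncate n m (λ j → h j k) n≤m (λ j n≤j → at (tail≋0 j n≤j) k))

ΣS-split : ∀ a b (h : ℕ → Series) → ΣS (a + b) h ≋ ΣS a h ⊕ ΣS b (λ i → h (a + i))
ΣS-split a b h = pt (λ k → Σ<-split a b (λ j → h j k))

ΣS-reverse : ∀ n (h : ℕ → Series) → ΣS n h ≋ ΣS n (λ i → h (n ∸ suc i))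
ΣS-reverse n h = pt (λ k → Σ<-reverse n (λ j → h j k))

infix 4 _≈[_]_
record _≈[_]_ (f : Series) (M : ℕ) (g : Series) : Set where
  constructor agree
  field below : ∀ n → n < M → f n ≡ g n
open _≈[_]_

≋⇒≈ : ∀ {f g} M → f ≋ g → f ≈[ M ] g
≋⇒≈ M f≋g = agree (λ n _ → at f≋g n)

≈-refl : ∀ {f M} → f ≈[ M ] f
≈-refl = agree (λ _ _ → refl)

≈-sym : ∀ {f g M} → f ≈[ M ] g → g ≈[ M ] f
≈-sym p = agree (λ n n<M → sym (below p n n<M))

≈-trans : ∀ {f g h M} → f ≈[ M ] g → g ≈[ M ] h → f ≈[ M ] h
≈-trans p q = agree (λ n n<M → trans (below p n n<M) (below q n n<M))

≈-weaken : ∀ {f g M} M′ → M′ ≤ M → f ≈[ M ] g → f ≈[ M′ ] g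
≈-weaken M′ M′≤M p = agree (λ n n<M′ → below p n (ℕP.<-≤-trans n<M′ M′≤M))

≈-⊕ : ∀ {f f′ g g′ M} → f ≈[ M ] f′ → g ≈[ M ] g′ → f ⊕ g ≈[ M ] f′ ⊕ g′
≈-⊕ p q = agree (λ n n<M → cong₂ _+ℤ_ (below p n n<M) (below q n n<M))

-- Truncated equality is a congruence for the product, since the
-- coefficient of qⁿ in f ⊛ g only involves coefficients up to qⁿ.
≈-⊛ : ∀ {f f′ g g′ M} → f ≈[ M ] f′ → g ≈[ M ] g′ → f ⊛ g ≈[ M ] f′ ⊛ g′
≈-⊛ p q = agree λ n n<M → Σ<-cong (suc n) λ i i≤n →
  cong₂ _*ℤ_ (below p i (ℕP.<-≤-trans i≤n n<M)) (below q (n ∸ i) (ℕP.≤-<-trans (ℕP.m∸n≤m n i) n<M))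

≈-ΣS : ∀ n {h h′ : ℕ → Series} {M} → (∀ j → j < n → h j ≈[ M ] h′ j) → ΣS n h ≈[ M ] ΣS n h′
≈-ΣS n p = agree (λ k k<M → Σ<-cong n (λ j j<n → below (p j j<n) k k<M))

≈-q^ : ∀ e {f g M} → f ≈[ M ] g → q^ e ⊛ f ≈[ e + M ] q^ e ⊛ g
≈-q^ e {f} {g} p = agree λ n n< →
  trans (at (q^-⊛ e f) n) (trans (below (shifted e p) n n<) (sym (at (q^-⊛ e g) n)))
  where
  shifted : ∀ e {f g M} → f ≈[ M ] g → shift e f ≈[ e + M ] shift e g
  shifted zero    p = p
  shifted (suc e) p = agree λ { zero _ → refl ; (suc n) (s≤s n<) → below (shifted e p) n n< }

-- Series with constant term 1 are cancellable, also in truncated form: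
-- the coefficient of qⁿ in U ⊛ X is X n plus terms involving only
-- lower coefficients of X.
cancel-below : ∀ {M} U X Y → U 0 ≡ 1ℤ → U ⊛ X ≈[ M ] U ⊛ Y → X ≈[ M ] Y
cancel-below {zero}  U X Y U₀≡1 _   = agree (λ _ ())
cancel-below {suc M} U X Y U₀≡1 UX≈UY = agree λ n n≤M → case-split n (ℕP.m≤n⇒m<n∨m≡n (ℕP.≤-pred n≤M))
  where
  lower : X ≈[ M ] Y
  lower = cancel-below U X Y U₀≡1 (≈-weaken M (ℕP.n≤1+n M) UX≈UY)
  topCoefficient : X M ≡ Y M
  topCoefficient = unit-cancel (trans (below UX≈UY M ℕP.≤-refl)
    (cong (U 0 *ℤ Y M +ℤ_) (Σ<-cong M (λ i i<M →
      cong (U (suc i) *ℤ_) (sym (below lower (M ∸ suc i) (ℕP.∸-monoʳ-< (s≤s z≤n) i<M)))))))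
    where
    unit-cancel : ∀ {x y r} → U 0 *ℤ x +ℤ r ≡ U 0 *ℤ y +ℤ r → x ≡ y
    unit-cancel {x} {y} {r} eq rewrite U₀≡1 =
      trans (sym (ℤP.*-identityˡ x)) (trans (+-cancelʳ r (1ℤ *ℤ x) (1ℤ *ℤ y) eq) (ℤP.*-identityˡ y))
  case-split : ∀ n → n < M ⊎ n ≡ M → X n ≡ Y n
  case-split n (inj₁ n<M) = below lower n n<M
  case-split n (inj₂ refl) = topCoefficient

cancel : ∀ U X Y → U 0 ≡ 1ℤ → U ⊛ X ≋ U ⊛ Y → X ≋ Y
cancel U X Y U₀≡1 UX≋UY =
  pt (λ n → below (cancel-below U X Y U₀≡1 (≋⇒≈ (suc n) UX≋UY)) n ℕP.≤-refl)

-- Overpartitions with bounded parts.  Defs computes ovp (m+1) n by summing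
-- over the multiplicity r+1 of the largest part m+1; we turn this into a
-- recurrence for the generating functions F m.
term : ℕ → ℕ → ℕ → ℕ
term m n r = if (suc r * suc m ≤ᵇ n) then 2 * ovp m (n ∸ suc r * suc m) else 0

term-fits : ∀ m n r → suc r * suc m ≤ n → term m n r ≡ 2 * ovp m (n ∸ suc r * suc m)
term-fits m n r fits with suc r * suc m ≤ᵇ n in eq
... | true  = refl
... | false = ⊥-elim (subst T eq (ℕP.≤⇒≤ᵇ fits))

term-tooBig : ∀ m n r → n < suc r * suc m → term m n r ≡ 0
term-tooBig m n r tooBig with suc r * suc m ≤ᵇ n in eq
... | false = refl
... | true  = ⊥-elim (ℕP.<⇒≱ tooBig (ℕP.≤ᵇ⇒≤ (suc r * suc m) n (subst T (sym eq) _)))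

term-shift : ∀ m p r → term m (suc m + p) (suc r) ≡ term m p r
term-shift m p r with suc r * suc m ℕP.≤? p
... | yes fits =
  trans (term-fits m (suc m + p) (suc r) (ℕP.+-monoʳ-≤ (suc m) fits))
        (trans (cong (λ x → 2 * ovp m x) (ℕP.[m+n]∸[m+o]≡n∸o (suc m) p (suc r * suc m)))
               (sym (term-fits m p r fits)))
... | no ¬fits =
  trans (term-tooBig m (suc m + p) (suc r) (ℕP.+-monoʳ-< (suc m) (ℕP.≰⇒> ¬fits)))
        (sym (term-tooBig m p r (ℕP.≰⇒> ¬fits)))

term-first : ∀ m p → term m (suc m + p) 0 ≡ 2 * ovp m p
term-first m p =
  trans (term-fits m (suc m + p) 0 (ℕP.+-monoʳ-≤ (suc m) z≤n))
        (cong (λ x → 2 * ovp m x) (ℕP.[m+n]∸[m+o]≡n∸o (suc m) p 0))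

F : ℕ → Series
F m n = + ovp m n

F-suc : ∀ m n → F (suc m) n ≡ F m n +ℤ Σ< n (λ r → + term m n r)
F-suc m n = trans (ℤP.pos-+ (ovp m n) _) (cong (F m n +ℤ_) (sum-upTo n (term m n)))

F-low : ∀ m n → n < suc m → F (suc m) n ≡ F m n
F-low m n n≤m =
  trans (F-suc m n)
        (trans (cong (F m n +ℤ_) (Σ<-vanish n _ (λ r → cong +_ (term-tooBig m n r
                  (ℕP.<-≤-trans n≤m (ℕP.m≤n*m (suc m) (suc r)))))))
               (ℤP.+-identityʳ _))

-- From qᵐ⁺¹ on: the part suc m occurs zero times, once, or at least once
-- more than in an overpartition of n - (m+1).
F-high : ∀ m p → F (suc m) (suc m + p) ≡ F m (suc m + p) +ℤ F m p +ℤ F (suc m) p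
F-high m p =
  begin
    F (suc m) (suc m + p)
  ≡⟨ F-suc m (suc m + p) ⟩
    F m (suc m + p) +ℤ (+ term m (suc m + p) 0 +ℤ Σ< (m + p) (λ r → + term m (suc m + p) (suc r)))
  ≡⟨ cong (λ x → F m (suc m + p) +ℤ (+ x +ℤ Σ< (m + p) (λ r → + term m (suc m + p) (suc r)))) (term-first m p) ⟩
    F m (suc m + p) +ℤ (+ (2 * ovp m p) +ℤ Σ< (m + p) (λ r → + term m (suc m + p) (suc r)))
  ≡⟨ cong₂ (λ x y → F m (suc m + p) +ℤ (x +ℤ y)) (ℤP.pos-* 2 (ovp m p)) moreCopies ⟩
    F m (suc m + p) +ℤ (+ 2 *ℤ F m p +ℤ (F (suc m) p +ℤ - F m p))
  ≡⟨ simplify (F m (suc m + p)) (F m p) (F (suc m) p) ⟩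
    F m (suc m + p) +ℤ F m p +ℤ F (suc m) p
  ∎
  where
  open ≡-Reasoning
  -- at least two copies of suc m: one copy fewer gives the overpartitions
  -- of p counted by F (suc m) p that do use suc m
  moreCopies : Σ< (m + p) (λ r → + term m (suc m + p) (suc r)) ≡ F (suc m) p +ℤ - F m p
  moreCopies =
    begin
      Σ< (m + p) (λ r → + term m (suc m + p) (suc r))
    ≡⟨ Σ<-cong′ (m + p) (λ r → cong +_ (term-shift m p r)) ⟩
      Σ< (m + p) (λ r → + term m p r)
    ≡⟨ Σ<-truncate p (m + p) (λ r → + term m p r) (ℕP.m≤n+m p m)
         (λ r p≤r → cong +_ (term-tooBig m p r (ℕP.<-≤-trans (s≤s p≤r) (ℕP.m≤m*n (suc r) (suc m))))) ⟩
      Σ< p (λ r → + term m p r)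
    ≡⟨ add-subtract (F m p) _ ⟩
      (F m p +ℤ Σ< p (λ r → + term m p r)) +ℤ - F m p
    ≡⟨ cong (_+ℤ - F m p) (sym (F-suc m p)) ⟩
      F (suc m) p +ℤ - F m p
    ∎
    where
    add-subtract : ∀ a b → b ≡ (a +ℤ b) +ℤ - a
    add-subtract = solve-∀
  simplify : ∀ a b c → a +ℤ (+ 2 *ℤ b +ℤ (c +ℤ - b)) ≡ a +ℤ b +ℤ c
  simplify = solve-∀

F-recurrence : ∀ m → F (suc m) ≋ F m ⊕ q^ suc m ⊛ F m ⊕ q^ suc m ⊛ F (suc m)
F-recurrence m = pt λ n → trans (pointwise n)
  (sym (cong₂ _+ℤ_ (cong (F m n +ℤ_) (at (q^-⊛ (suc m) (F m)) n)) (at (q^-⊛ (suc m) (F (suc m))) n)))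
  where
  pointwise : ∀ n → F (suc m) n ≡ F m n +ℤ shift (suc m) (F m) n +ℤ shift (suc m) (F (suc m)) n
  pointwise n with n ℕP.<? suc m
  ... | yes n≤m rewrite shift-below (suc m) (F m) n n≤m | shift-below (suc m) (F (suc m)) n n≤m =
    trans (F-low m n n≤m) (sym (trans (ℤP.+-identityʳ _) (ℤP.+-identityʳ _)))
  ... | no n≮m rewrite sym (ℕP.m+[n∸m]≡n (ℕP.≮⇒≥ n≮m))
                     | shift-above (suc m) (F m) (n ∸ suc m)
                     | shift-above (suc m) (F (suc m)) (n ∸ suc m) = F-high m (n ∸ suc m)

F-zero : F 0 ≋ 𝟙
F-zero = pt λ { zero → refl ; (suc n) → refl }

F-stable : ∀ m n → n ≤ m → F m n ≡ + pbar n
F-stable m n n≤m rewrite sym (ℕP.m+[n∸m]≡n n≤m) = go (m ∸ n)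
  where
  go : ∀ d → F (n + d) n ≡ + pbar n
  go zero    = cong (λ x → F x n) (ℕP.+-identityʳ n)
  go (suc d) rewrite ℕP.+-suc n d = trans (F-low (n + d) n (s≤s (ℕP.m≤m+n n d))) (go d)

1-q^_ : ℕ → Series
1-q^ e = 𝟙 ⊕ ⊝ q^ e

1+q^_ : ℕ → Series
1+q^ e = 𝟙 ⊕ q^ e

1-q^-cong : ∀ {a b} → a ≡ b → 1-q^ a ≋ 1-q^ b
1-q^-cong refl = ≋-refl

poch : ℕ → Series
poch zero    = 𝟙
poch (suc r) = poch r ⊛ 1-q^ suc r

pochPlus : ℕ → Series
pochPlus zero    = 𝟙
pochPlus (suc r) = pochPlus r ⊛ 1+q^ suc r

poch² : ℕ → Series
poch² zero    = 𝟙
poch² (suc r) = poch² r ⊛ 1-q^ (2 * suc r)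

pochOdd : ℕ → Series
pochOdd zero    = 𝟙
pochOdd (suc r) = pochOdd r ⊛ 1-q^ suc (2 * r)

-- All these products have constant term 1, hence are cancellable.
poch-at-0 : ∀ r → poch r 0 ≡ 1ℤ
poch-at-0 zero    = refl
poch-at-0 (suc r) = trans (⊛-at-0 (poch r) (1-q^ suc r)) (cong (_*ℤ 1ℤ) (poch-at-0 r))

pochPlus-at-0 : ∀ r → pochPlus r 0 ≡ 1ℤ
pochPlus-at-0 zero    = refl
pochPlus-at-0 (suc r) = trans (⊛-at-0 (pochPlus r) (1+q^ suc r)) (cong (_*ℤ 1ℤ) (pochPlus-at-0 r))

poch²-at-0 : ∀ r → poch² r 0 ≡ 1ℤ
poch²-at-0 zero    = refl
poch²-at-0 (suc r) = trans (⊛-at-0 (poch² r) (1-q^ (2 * suc r))) (cong (_*ℤ 1ℤ) (poch²-at-0 r))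

F-product : ∀ r → F r ⊛ poch r ≋ pochPlus r
F-product zero = ≋-trans (⊛-identityʳ (F 0)) F-zero
F-product (suc r) =
  begin≋
    F (suc r) ⊛ (poch r ⊛ (𝟙 ⊕ ⊝ X))
  ≈⟨ solve 3 (λ f p x → f :* (p :* (con 1ℤ :- x)) := p :* (f :- x :* f)) ≋-refl (F (suc r)) (poch r) X ⟩
    poch r ⊛ (F (suc r) ⊕ ⊝ (X ⊛ F (suc r)))
  ≈⟨ ⊛-cong (≋-refl {poch r}) recurrence ⟩
    poch r ⊛ (F r ⊕ X ⊛ F r)
  ≈⟨ solve 3 (λ f p x → p :* (f :+ x :* f) := (f :* p) :* (con 1ℤ :+ x)) ≋-refl (F r) (poch r) X ⟩
    (F r ⊛ poch r) ⊛ (𝟙 ⊕ X)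
  ≈⟨ ⊛-cong (F-product r) ≋-refl ⟩
    pochPlus (suc r)
  ∎≋
  where
  X = q^ suc r
  recurrence : F (suc r) ⊕ ⊝ (X ⊛ F (suc r)) ≋ F r ⊕ X ⊛ F r
  recurrence =
    ≋-trans (⊕-cong (F-recurrence r) ≋-refl)
            (solve 3 (λ f f′ x → f :+ x :* f :+ x :* f′ :- x :* f′ := f :+ x :* f) ≋-refl (F r) (F (suc r)) X)

-- 1 - q²ⁱ = (1 - qⁱ)(1 + qⁱ), hence (q²;q²)_r = (q;q)_r (-q;q)_r.
poch²-split : ∀ r → poch² r ≋ poch r ⊛ pochPlus r
poch²-split zero = ≋-sym (⊛-identityʳ 𝟙)
poch²-split (suc r) =
  ≋-trans (⊛-cong (poch²-split r) difference-of-squares)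
          (solve 4 (λ p q o l → p :* q :* (o :* l) := p :* o :* (q :* l)) ≋-refl
                 (poch r) (pochPlus r) (1-q^ suc r) (1+q^ suc r))
  where
  X = q^ suc r
  difference-of-squares : 1-q^ (2 * suc r) ≋ 1-q^ suc r ⊛ 1+q^ suc r
  difference-of-squares =
    ≋-trans (⊕-cong (≋-refl {𝟙}) (⊝-cong (≋-trans (q^-cong (cong (_+_ (suc r)) (ℕP.+-identityʳ (suc r))))
                                                 (q^-+ (suc r) (suc r)))))
            (solve 1 (λ x → con 1ℤ :- x :* x := (con 1ℤ :- x) :* (con 1ℤ :+ x)) ≋-refl X)

twice : ∀ s → 2 * s ≡ s + s
twice s = cong (_+_ s) (ℕP.+-identityʳ s)

poch-evenOdd : ∀ m → poch (m + m) ≋ pochOdd m ⊛ poch² m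
poch-evenOdd zero = ≋-sym (⊛-identityʳ 𝟙)
poch-evenOdd (suc m) rewrite ℕP.+-suc m m =
  ≋-trans (⊛-cong (⊛-cong (poch-evenOdd m) (1-q^-cong (cong suc (sym (twice m)))))
                  (1-q^-cong (trans (cong (suc ∘ suc) (sym (twice m))) (sym (cong suc (ℕP.+-suc m (m + 0)))))))
          (solve 4 (λ o q a b → o :* q :* a :* b := o :* a :* (q :* b)) ≋-refl
                 (pochOdd m) (poch² m) (1-q^ suc (2 * m)) (1-q^ (2 * suc m)))

1-q^-≈𝟙 : ∀ e → 1-q^ e ≈[ e ] 𝟙
1-q^-≈𝟙 e = agree (λ n n<e → trans (cong (λ x → 𝟙 n +ℤ - x) (shift-below e 𝟙 n n<e)) (ℤP.+-identityʳ (𝟙 n)))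

poch²-approx : ∀ r d → poch² (r + d) ≈[ 2 * suc r ] poch² r
poch²-approx r zero rewrite ℕP.+-identityʳ r = ≈-refl
poch²-approx r (suc d) rewrite ℕP.+-suc r d =
  ≈-trans (≈-trans (≈-⊛ (≈-refl {poch² (r + d)})
                        (≈-weaken (2 * suc r) (ℕP.*-monoʳ-≤ 2 (s≤s (ℕP.m≤m+n r d))) (1-q^-≈𝟙 (2 * suc (r + d)))))
                   (≋⇒≈ _ (⊛-identityʳ (poch² (r + d)))))
          (poch²-approx r d)

gbinom : ℕ → ℕ → Series
gbinom zero    zero    = 𝟙
gbinom zero    (suc j) = 𝟘
gbinom (suc N) zero    = 𝟙
gbinom (suc N) (suc j) = gbinom N j ⊕ q^ (2 * suc j) ⊛ gbinom N (suc j)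

gbinom-0 : ∀ N → gbinom N 0 ≋ 𝟙
gbinom-0 zero    = ≋-refl
gbinom-0 (suc N) = ≋-refl

gbinom-vanish : ∀ N j → N < j → gbinom N j ≋ 𝟘
gbinom-vanish zero    (suc j) _         = ≋-refl
gbinom-vanish (suc N) (suc j) (s≤s N<j) =
  ≋-trans (⊕-cong (gbinom-vanish N j N<j)
                  (≋-trans (⊛-cong (≋-refl {q^ (2 * suc j)}) (gbinom-vanish N (suc j) (ℕP.m<n⇒m<1+n N<j)))
                           (⊛-zeroʳ (q^ (2 * suc j)))))
          (pt (λ _ → refl))

2*-+ : ∀ a b → 2 * a + 2 * b ≡ 2 * (a + b)
2*-+ a b = sym (ℕP.*-distribˡ-+ 2 a b)

gbinom-product : ∀ j d → gbinom (j + d) j ⊛ poch² j ⊛ poch² d ≋ poch² (j + d)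
gbinom-product zero d =
  ≋-trans (⊛-cong (⊛-cong (gbinom-0 d) ≋-refl) ≋-refl)
          (solve 1 (λ p → con 1ℤ :* con 1ℤ :* p := p) ≋-refl (poch² d))
gbinom-product (suc j) zero =
  begin≋
    (B₀ ⊕ Y ⊛ gbinom (j + 0) (suc j)) ⊛ (poch² j ⊛ (𝟙 ⊕ ⊝ Y)) ⊛ 𝟙
  ≈⟨ ⊛-cong (⊛-cong (⊕-cong (≋-refl {B₀}) top≋0) ≋-refl) ≋-refl ⟩
    (B₀ ⊕ 𝟘) ⊛ (poch² j ⊛ (𝟙 ⊕ ⊝ Y)) ⊛ 𝟙
  ≈⟨ solve 3 (λ b p y → (b :+ con 0ℤ) :* (p :* (con 1ℤ :- y)) :* con 1ℤ := (b :* p :* con 1ℤ) :* (con 1ℤ :- y))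
           ≋-refl B₀ (poch² j) Y ⟩
    (B₀ ⊛ poch² j ⊛ 𝟙) ⊛ (𝟙 ⊕ ⊝ Y)
  ≈⟨ ⊛-cong (gbinom-product j 0) (1-q^-cong (cong (λ x → 2 * suc x) (sym (ℕP.+-identityʳ j)))) ⟩
    poch² (suc (j + 0))
  ∎≋
  where
  B₀ = gbinom (j + 0) j
  Y = q^ (2 * suc j)
  top≋0 : Y ⊛ gbinom (j + 0) (suc j) ≋ 𝟘
  top≋0 = ≋-trans (⊛-cong (≋-refl {Y}) (gbinom-vanish (j + 0) (suc j) (s≤s (ℕP.≤-reflexive (ℕP.+-identityʳ j)))))
                  (⊛-zeroʳ Y)
gbinom-product (suc j) (suc d) =
  begin≋
    (B₀ ⊕ Y ⊛ B₁) ⊛ (poch² j ⊛ (𝟙 ⊕ ⊝ Y)) ⊛ (poch² d ⊛ (𝟙 ⊕ ⊝ Z))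
  ≈⟨ solve 6 (λ b₀ b₁ y z p₁ p₂ → (b₀ :+ y :* b₁) :* (p₁ :* (con 1ℤ :- y)) :* (p₂ :* (con 1ℤ :- z))
                 := (con 1ℤ :- y) :* (b₀ :* p₁ :* (p₂ :* (con 1ℤ :- z)))
                    :+ (y :* (con 1ℤ :- z)) :* (b₁ :* (p₁ :* (con 1ℤ :- y)) :* p₂))
       ≋-refl B₀ B₁ Y Z (poch² j) (poch² d) ⟩
    (𝟙 ⊕ ⊝ Y) ⊛ (B₀ ⊛ poch² j ⊛ poch² (suc d)) ⊕ (Y ⊛ (𝟙 ⊕ ⊝ Z)) ⊛ (B₁ ⊛ poch² (suc j) ⊛ poch² d)
  ≈⟨ ⊕-cong (⊛-cong (≋-refl {𝟙 ⊕ ⊝ Y}) (gbinom-product j (suc d))) (⊛-cong (≋-refl {Y ⊛ (𝟙 ⊕ ⊝ Z)}) shorter) ⟩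
    (𝟙 ⊕ ⊝ Y) ⊛ P ⊕ (Y ⊛ (𝟙 ⊕ ⊝ Z)) ⊛ P
  ≈⟨ solve 3 (λ y z p → (con 1ℤ :- y) :* p :+ (y :* (con 1ℤ :- z)) :* p := p :* (con 1ℤ :- y :* z)) ≋-refl Y Z P ⟩
    P ⊛ (𝟙 ⊕ ⊝ (Y ⊛ Z))
  ≈⟨ ⊛-cong (≋-refl {P}) (⊕-cong (≋-refl {𝟙}) (⊝-cong (≋-sym (q^-+ (2 * suc j) (2 * suc d))))) ⟩
    P ⊛ (𝟙 ⊕ ⊝ q^ (2 * suc j + 2 * suc d))
  ≈⟨ ⊛-cong (≋-refl {P}) (1-q^-cong (2*-+ (suc j) (suc d))) ⟩
    poch² (suc (j + suc d))
  ∎≋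
  where
  B₀ = gbinom (j + suc d) j
  B₁ = gbinom (j + suc d) (suc j)
  Y = q^ (2 * suc j)
  Z = q^ (2 * suc d)
  P = poch² (j + suc d)
  shorter : B₁ ⊛ poch² (suc j) ⊛ poch² d ≋ P
  shorter = subst (λ N → gbinom N (suc j) ⊛ poch² (suc j) ⊛ poch² d ≋ poch² N)
                  (sym (ℕP.+-suc j d)) (gbinom-product (suc j) d)

-- The companion of the product formula for [j+d, j+1]; the factor
-- 1 - q^(2d) accounts for the missing factor of (q²;q²)_(j+d).
gbinom-product′ : ∀ j d → gbinom (j + d) (suc j) ⊛ poch² (suc j) ⊛ poch² d ≋ poch² (j + d) ⊛ 1-q^ (2 * d)
gbinom-product′ j zero =
  begin≋
    gbinom (j + 0) (suc j) ⊛ poch² (suc j) ⊛ 𝟙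
  ≈⟨ ⊛-cong (⊛-cong (gbinom-vanish (j + 0) (suc j) (s≤s (ℕP.≤-reflexive (ℕP.+-identityʳ j)))) ≋-refl) ≋-refl ⟩
    𝟘 ⊛ poch² (suc j) ⊛ 𝟙
  ≈⟨ solve 2 (λ p r → con 0ℤ :* p :* con 1ℤ := r :* (con 1ℤ :- con 1ℤ)) ≋-refl (poch² (suc j)) (poch² (j + 0)) ⟩
    poch² (j + 0) ⊛ 1-q^ 0
  ∎≋
gbinom-product′ j (suc d) =
  ≋-trans (solve 4 (λ b p r z → b :* p :* (r :* z) := (b :* p :* r) :* z) ≋-refl
                 (gbinom (j + suc d) (suc j)) (poch² (suc j)) (poch² d) (1-q^ (2 * suc d)))
          (⊛-cong shorter ≋-refl)
  where
  shorter : gbinom (j + suc d) (suc j) ⊛ poch² (suc j) ⊛ poch² d ≋ poch² (j + suc d)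
  shorter = subst (λ N → gbinom N (suc j) ⊛ poch² (suc j) ⊛ poch² d ≋ poch² N)
                  (sym (ℕP.+-suc j d)) (gbinom-product (suc j) d)

-- The second Pascal rule  [j+d+1, j+1] = [j+d, j+1] + q^(2d) [j+d, j],
-- obtained by cancelling (q²;q²)_(j+1) (q²;q²)_d from both product formulas.
gbinom-pascal′ : ∀ j d → gbinom (suc (j + d)) (suc j) ≋ gbinom (j + d) (suc j) ⊕ q^ (2 * d) ⊛ gbinom (j + d) j
gbinom-pascal′ j d = cancel U _ _ U₀≡1 (≋-trans viaProduct (≋-sym viaPascal))
  where
  U = poch² (suc j) ⊛ poch² d
  Y = q^ (2 * suc j)
  Z = q^ (2 * d)
  P = poch² (j + d)
  U₀≡1 : U 0 ≡ 1ℤ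
  U₀≡1 = trans (⊛-at-0 (poch² (suc j)) (poch² d)) (cong₂ _*ℤ_ (poch²-at-0 (suc j)) (poch²-at-0 d))
  viaProduct : U ⊛ gbinom (suc (j + d)) (suc j) ≋ poch² (suc (j + d))
  viaProduct =
    ≋-trans (solve 3 (λ a b c → (a :* b) :* c := c :* a :* b) ≋-refl
                   (poch² (suc j)) (poch² d) (gbinom (suc (j + d)) (suc j)))
            (gbinom-product (suc j) d)
  viaPascal : U ⊛ (gbinom (j + d) (suc j) ⊕ Z ⊛ gbinom (j + d) j) ≋ poch² (suc (j + d))
  viaPascal =
    begin≋
      (poch² j ⊛ (𝟙 ⊕ ⊝ Y) ⊛ poch² d) ⊛ (gbinom (j + d) (suc j) ⊕ Z ⊛ gbinom (j + d) j)
    ≈⟨ solve 6 (λ p y r b₁ z b₀ → (p :* (con 1ℤ :- y) :* r) :* (b₁ :+ z :* b₀)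
                   := b₁ :* (p :* (con 1ℤ :- y)) :* r :+ (z :* (con 1ℤ :- y)) :* (b₀ :* p :* r))
         ≋-refl (poch² j) Y (poch² d) (gbinom (j + d) (suc j)) Z (gbinom (j + d) j) ⟩
      gbinom (j + d) (suc j) ⊛ poch² (suc j) ⊛ poch² d ⊕ (Z ⊛ (𝟙 ⊕ ⊝ Y)) ⊛ (gbinom (j + d) j ⊛ poch² j ⊛ poch² d)
    ≈⟨ ⊕-cong (gbinom-product′ j d) (⊛-cong (≋-refl {Z ⊛ (𝟙 ⊕ ⊝ Y)}) (gbinom-product j d)) ⟩
      P ⊛ (𝟙 ⊕ ⊝ Z) ⊕ (Z ⊛ (𝟙 ⊕ ⊝ Y)) ⊛ P
    ≈⟨ solve 3 (λ p z y → p :* (con 1ℤ :- z) :+ (z :* (con 1ℤ :- y)) :* p := p :* (con 1ℤ :- z :* y)) ≋-refl P Z Y ⟩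
      P ⊛ (𝟙 ⊕ ⊝ (Z ⊛ Y))
    ≈⟨ ⊛-cong (≋-refl {P}) (⊕-cong (≋-refl {𝟙}) (⊝-cong (≋-sym (q^-+ (2 * d) (2 * suc j))))) ⟩
      P ⊛ 1-q^ (2 * d + 2 * suc j)
    ≈⟨ ⊛-cong (≋-refl {P}) (1-q^-cong (trans (2*-+ d (suc j)) (cong (2 *_) (trans (ℕP.+-suc d j) (cong suc (ℕP.+-comm d j)))))) ⟩
      poch² (suc (j + d))
    ∎≋

gbinom-pascal′-at : ∀ N j → j ≤ N → gbinom (suc N) (suc j) ≋ gbinom N (suc j) ⊕ q^ (2 * (N ∸ j)) ⊛ gbinom N j
gbinom-pascal′-at N j j≤N =
  subst (λ M → gbinom (suc M) (suc j) ≋ gbinom M (suc j) ⊕ q^ (2 * (N ∸ j)) ⊛ gbinom M j)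
        (ℕP.m+[n∸m]≡n j≤N) (gbinom-pascal′ j (N ∸ j))

altSign : ℕ → ℤ
altSign zero    = 1ℤ
altSign (suc j) = - altSign j

altSign-+suc : ∀ j b → altSign (j + suc b) ≡ - altSign (j + b)
altSign-+suc j b = cong altSign (ℕP.+-suc j b)

altSign-suc-suc : ∀ j b → altSign (suc j + suc b) ≡ altSign (j + b)
altSign-suc-suc j b = trans (cong -_ (altSign-+suc j b)) (ℤP.neg-involutive _)

sq : ℕ → ℕ
sq x = x * x

sq-distance-suc : ∀ j b → sq ∣ j - suc b ∣ + 2 * j ≡ sq ∣ j - b ∣ + suc (2 * b)
sq-distance-suc zero b = lemma b
  where
  lemma : ∀ b → suc b * suc b + 2 * 0 ≡ b * b + suc (2 * b)
  lemma = ℕSolver.solve-∀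
sq-distance-suc (suc j) zero rewrite ℕP.∣-∣-identityʳ j = lemma j
  where
  lemma : ∀ j → j * j + 2 * suc j ≡ suc j * suc j + suc (2 * 0)
  lemma = ℕSolver.solve-∀
sq-distance-suc (suc j) (suc b) =
  trans (lemma (sq ∣ j - suc b ∣) j) (trans (cong (_+ 2) (sq-distance-suc j b)) (lemma′ (sq ∣ j - b ∣) b))
  where
  lemma : ∀ x j → x + 2 * suc j ≡ (x + 2 * j) + 2
  lemma = ℕSolver.solve-∀
  lemma′ : ∀ x b → x + suc (2 * b) + 2 ≡ x + suc (2 * suc b)
  lemma′ = ℕSolver.solve-∀

sq-suc-offset : ∀ j d → sq (suc j) + 2 * d ≡ sq j + suc (2 * (j + d))
sq-suc-offset = lemma
  where
  lemma : ∀ j d → suc j * suc j + 2 * d ≡ j * j + suc (2 * (j + d))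
  lemma = ℕSolver.solve-∀

jacobiTerm : ℕ → ℕ → ℕ → Series
jacobiTerm N b j = const (altSign (j + b)) ⊛ q^ sq ∣ j - b ∣ ⊛ gbinom N j

jacobiSum : ℕ → ℕ → Series
jacobiSum N b = ΣS (suc N) (jacobiTerm N b)

-- Terms with j > N vanish, so sums may be extended past j = N.
term-vanish : ∀ c e N j → N < j → const c ⊛ q^ e ⊛ gbinom N j ≋ 𝟘
term-vanish c e N j N<j =
  ≋-trans (⊛-cong (≋-refl {const c ⊛ q^ e}) (gbinom-vanish N j N<j)) (⊛-zeroʳ (const c ⊛ q^ e))

ΣS-factor : ∀ n X (u : ℕ → Series) → ΣS n u ⊕ ΣS n (λ j → ⊝ (X ⊛ u j)) ≋ (𝟙 ⊕ ⊝ X) ⊛ ΣS n u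
ΣS-factor n X u =
  ≋-trans (⊕-cong (≋-refl {ΣS n u}) (≋-trans (ΣS-⊝ n (λ j → X ⊛ u j)) (⊝-cong (≋-sym (ΣS-⊛ n X u)))))
          (solve 2 (λ e x → e :- x :* e := (con 1ℤ :- x) :* e) ≋-refl (ΣS n u) X)

-- With b = 0, the second Pascal rule splits the (j+1)-st term of the sum for
-- N = a + 1 into the (j+1)-st term for N = a and -q^(2a+1) times the j-th one.
jacobiTerm-pascal₀ : ∀ a j → j ≤ a →
  jacobiTerm (suc a) 0 (suc j) ≋ jacobiTerm a 0 (suc j) ⊕ ⊝ (q^ suc (2 * a) ⊛ jacobiTerm a 0 j)
jacobiTerm-pascal₀ a j j≤a =
  begin≋
    C′ ⊛ Q′ ⊛ gbinom (suc a) (suc j)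
  ≈⟨ ⊛-cong (≋-refl {C′ ⊛ Q′}) (gbinom-pascal′-at a j j≤a) ⟩
    C′ ⊛ Q′ ⊛ (gbinom a (suc j) ⊕ q^ (2 * (a ∸ j)) ⊛ gbinom a j)
  ≈⟨ solve 5 (λ c m b₁ y b₀ → c :* m :* (b₁ :+ y :* b₀) := c :* m :* b₁ :+ c :* (m :* y) :* b₀) ≋-refl
           C′ Q′ (gbinom a (suc j)) (q^ (2 * (a ∸ j))) (gbinom a j) ⟩
    jacobiTerm a 0 (suc j) ⊕ C′ ⊛ (Q′ ⊛ q^ (2 * (a ∸ j))) ⊛ gbinom a j
  ≈⟨ ⊕-cong (≋-refl {jacobiTerm a 0 (suc j)}) (⊛-cong (⊛-cong (const-neg (altSign (j + 0))) exponent) ≋-refl) ⟩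
    jacobiTerm a 0 (suc j) ⊕ ⊝ C ⊛ (Q ⊛ X) ⊛ gbinom a j
  ≈⟨ ⊕-cong (≋-refl {jacobiTerm a 0 (suc j)})
            (solve 4 (λ c m x b → (:- c) :* (m :* x) :* b := :- (x :* (c :* m :* b))) ≋-refl C Q X (gbinom a j)) ⟩
    jacobiTerm a 0 (suc j) ⊕ ⊝ (X ⊛ jacobiTerm a 0 j)
  ∎≋
  where
  X = q^ suc (2 * a)
  C = const (altSign (j + 0))
  C′ = const (altSign (suc j + 0))
  Q = q^ sq ∣ j - 0 ∣
  Q′ = q^ sq (suc j)
  exponent : Q′ ⊛ q^ (2 * (a ∸ j)) ≋ Q ⊛ X
  exponent =
    ≋-trans (≋-sym (q^-+ (sq (suc j)) (2 * (a ∸ j))))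
            (≋-trans (q^-cong (trans (sq-suc-offset j (a ∸ j))
                                      (cong₂ (λ x y → sq x + suc (2 * y)) (sym (ℕP.∣-∣-identityʳ j)) (ℕP.m+[n∸m]≡n j≤a))))
                     (q^-+ (sq ∣ j - 0 ∣) (suc (2 * a))))

jacobi-step₀ : ∀ a → jacobiSum (suc a) 0 ≋ 1-q^ suc (2 * a) ⊛ jacobiSum a 0
jacobi-step₀ a =
  begin≋
    jacobiTerm (suc a) 0 0 ⊕ ΣS (suc a) (jacobiTerm (suc a) 0 ∘ suc)
  ≈⟨ ⊕-cong (⊛-cong (≋-refl {const 1ℤ ⊛ q^ 0}) (≋-sym (gbinom-0 a)))
            (ΣS-cong (suc a) (λ j j≤a → jacobiTerm-pascal₀ a j (ℕP.≤-pred j≤a))) ⟩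
    u 0 ⊕ ΣS (suc a) (λ j → u (suc j) ⊕ ⊝ (X ⊛ u j))
  ≈⟨ ⊕-cong (≋-refl {u 0}) (ΣS-⊕ (suc a) (u ∘ suc) (λ j → ⊝ (X ⊛ u j))) ⟩
    u 0 ⊕ (ΣS (suc a) (u ∘ suc) ⊕ ΣS (suc a) (λ j → ⊝ (X ⊛ u j)))
  ≈⟨ solve 3 (λ x y z → x :+ (y :+ z) := (x :+ y) :+ z) ≋-refl (u 0) (ΣS (suc a) (u ∘ suc)) (ΣS (suc a) (λ j → ⊝ (X ⊛ u j))) ⟩
    ΣS (suc (suc a)) u ⊕ ΣS (suc a) (λ j → ⊝ (X ⊛ u j))
  ≈⟨ ⊕-cong (ΣS-truncate (suc a) (suc (suc a)) u (ℕP.n≤1+n (suc a))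
                         (λ j a<j → term-vanish (altSign (j + 0)) (sq ∣ j - 0 ∣) a j a<j)) ≋-refl ⟩
    jacobiSum a 0 ⊕ ΣS (suc a) (λ j → ⊝ (X ⊛ u j))
  ≈⟨ ΣS-factor (suc a) X u ⟩
    1-q^ suc (2 * a) ⊛ jacobiSum a 0
  ∎≋
  where
  X = q^ suc (2 * a)
  u = jacobiTerm a 0

-- The terms moved one step by the Pascal rule in passing from (N, b) to (N+1, b+1).
movedTerm : ℕ → ℕ → ℕ → Series
movedTerm N b j = const (altSign (j + suc b)) ⊛ q^ (sq ∣ j - suc b ∣ + 2 * j) ⊛ gbinom N j

-- The Pascal rule splits the (j+1)-st term for (N+1, b+1) into the j-th term
-- for (N, b) and a moved term ...
jacobiTerm-pascal : ∀ N b j → jacobiTerm (suc N) (suc b) (suc j) ≋ jacobiTerm N b j ⊕ movedTerm N b (suc j)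
jacobiTerm-pascal N b j =
  begin≋
    C′ ⊛ Q ⊛ (gbinom N j ⊕ q^ (2 * suc j) ⊛ gbinom N (suc j))
  ≈⟨ ⊛-cong (⊛-cong (const-cong (altSign-suc-suc j b)) (≋-refl {Q})) ≋-refl ⟩
    C ⊛ Q ⊛ (gbinom N j ⊕ q^ (2 * suc j) ⊛ gbinom N (suc j))
  ≈⟨ solve 5 (λ c m b₀ y b₁ → c :* m :* (b₀ :+ y :* b₁) := c :* m :* b₀ :+ c :* (m :* y) :* b₁) ≋-refl
           C Q (gbinom N j) (q^ (2 * suc j)) (gbinom N (suc j)) ⟩
    jacobiTerm N b j ⊕ C ⊛ (Q ⊛ q^ (2 * suc j)) ⊛ gbinom N (suc j)
  ≈⟨ ⊕-cong (≋-refl {jacobiTerm N b j}) (⊛-cong (⊛-cong (const-cong (sym (altSign-suc-suc j b)))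
                                                       (≋-sym (q^-+ (sq ∣ j - b ∣) (2 * suc j)))) ≋-refl) ⟩
    jacobiTerm N b j ⊕ movedTerm N b (suc j)
  ∎≋
  where
  C = const (altSign (j + b))
  C′ = const (altSign (suc j + suc b))
  Q = q^ sq ∣ j - b ∣

movedTerm-factor : ∀ N b j → movedTerm N b j ≋ ⊝ (q^ suc (2 * b) ⊛ jacobiTerm N b j)
movedTerm-factor N b j =
  begin≋
    const (altSign (j + suc b)) ⊛ q^ (sq ∣ j - suc b ∣ + 2 * j) ⊛ gbinom N j
  ≈⟨ ⊛-cong (⊛-cong (≋-trans (const-cong (altSign-+suc j b)) (const-neg (altSign (j + b))))
                    (≋-trans (q^-cong (sq-distance-suc j b)) (q^-+ (sq ∣ j - b ∣) (suc (2 * b))))) ≋-refl ⟩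
    ⊝ C ⊛ (Q ⊛ X) ⊛ gbinom N j
  ≈⟨ solve 4 (λ c m x g → (:- c) :* (m :* x) :* g := :- (x :* (c :* m :* g))) ≋-refl C Q X (gbinom N j) ⟩
    ⊝ (X ⊛ jacobiTerm N b j)
  ∎≋
  where
  X = q^ suc (2 * b)
  C = const (altSign (j + b))
  Q = q^ sq ∣ j - b ∣

jacobi-step : ∀ N b → jacobiSum (suc N) (suc b) ≋ 1-q^ suc (2 * b) ⊛ jacobiSum N b
jacobi-step N b =
  begin≋
    next 0 ⊕ ΣS (suc N) (next ∘ suc)
  ≈⟨ ⊕-cong firstTerm (ΣS-cong (suc N) (λ j _ → jacobiTerm-pascal N b j)) ⟩
    w 0 ⊕ ΣS (suc N) (λ j → u j ⊕ w (suc j))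
  ≈⟨ ⊕-cong (≋-refl {w 0}) (ΣS-⊕ (suc N) u (w ∘ suc)) ⟩
    w 0 ⊕ (ΣS (suc N) u ⊕ ΣS (suc N) (w ∘ suc))
  ≈⟨ solve 3 (λ x y z → x :+ (y :+ z) := y :+ (x :+ z)) ≋-refl (w 0) (ΣS (suc N) u) (ΣS (suc N) (w ∘ suc)) ⟩
    jacobiSum N b ⊕ ΣS (suc (suc N)) w
  ≈⟨ ⊕-cong (≋-refl {jacobiSum N b})
            (ΣS-truncate (suc N) (suc (suc N)) w (ℕP.n≤1+n (suc N))
                         (λ j N<j → term-vanish (altSign (j + suc b)) (sq ∣ j - suc b ∣ + 2 * j) N j N<j)) ⟩
    jacobiSum N b ⊕ ΣS (suc N) w
  ≈⟨ ⊕-cong (≋-refl {jacobiSum N b}) (ΣS-cong (suc N) (λ j _ → movedTerm-factor N b j)) ⟩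
    jacobiSum N b ⊕ ΣS (suc N) (λ j → ⊝ (X ⊛ u j))
  ≈⟨ ΣS-factor (suc N) X u ⟩
    1-q^ suc (2 * b) ⊛ jacobiSum N b
  ∎≋
  where
  X = q^ suc (2 * b)
  next = jacobiTerm (suc N) (suc b)
  u = jacobiTerm N b
  w = movedTerm N b
  firstTerm : next 0 ≋ w 0
  firstTerm = ⊛-cong (⊛-cong (≋-refl {const (altSign (suc b))}) (q^-cong (sym (ℕP.+-identityʳ (sq (suc b))))))
                     (≋-sym (gbinom-0 N))

jacobi-base : ∀ a → jacobiSum a 0 ≋ pochOdd a
jacobi-base zero    =
  ≋-trans (pt (λ n → ℤP.+-identityʳ _)) (solve 0 (con 1ℤ :* con 1ℤ :* con 1ℤ := con 1ℤ) ≋-refl)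
jacobi-base (suc a) =
  ≋-trans (jacobi-step₀ a) (≋-trans (⊛-cong (≋-refl {1-q^ suc (2 * a)}) (jacobi-base a)) (⊛-comm (1-q^ suc (2 * a)) (pochOdd a)))

finite-jacobi : ∀ a b → jacobiSum (a + b) b ≋ pochOdd a ⊛ pochOdd b
finite-jacobi a zero rewrite ℕP.+-identityʳ a = ≋-trans (jacobi-base a) (≋-sym (⊛-identityʳ (pochOdd a)))
finite-jacobi a (suc b) rewrite ℕP.+-suc a b =
  ≋-trans (jacobi-step (a + b) b)
          (≋-trans (⊛-cong (≋-refl {1-q^ suc (2 * b)}) (finite-jacobi a b))
                   (solve 3 (λ o x y → o :* (x :* y) := x :* (y :* o)) ≋-refl (1-q^ suc (2 * b)) (pochOdd a) (pochOdd b)))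

squareTerm : ℕ → Series
squareTerm i = const (altSign (suc i)) ⊛ q^ sq (suc i)

-- The coefficient of qⁿ in A only involves the terms with (i+1)² ≤ n, hence i < n.
A : Series
A n = ΣS n squareTerm n

squareTerm-low : ∀ i n → n ≤ i → squareTerm i n ≡ 0ℤ
squareTerm-low i n n≤i =
  trans (const-⊛ (altSign (suc i)) (q^ sq (suc i)) n)
        (trans (cong (altSign (suc i) *ℤ_) (shift-below (sq (suc i)) 𝟙 n
                       (ℕP.<-≤-trans (s≤s n≤i) (ℕP.m≤m*n (suc i) (suc i)))))
               (ℤP.*-zeroʳ (altSign (suc i))))

A-partial : ∀ m → ΣS m squareTerm ≈[ suc m ] A
A-partial m = agree (λ n n≤m →
  Σ<-truncate n m (λ i → squareTerm i n) (ℕP.≤-pred n≤m) (λ i n≤i → squareTerm-low i n n≤i))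

-- φ(-q) = Σ_{n ∈ ℤ} (-1)ⁿ q^(n²) = 1 + 2A.
φ₋ : Series
φ₋ = 𝟙 ⊕ const (+ 2) ⊛ A

-- The truncated theta series Σ_{j ≤ 2m} (-1)^(j+m) q^((j-m)²), i.e. |n| ≤ m.
thetaTerm : ℕ → ℕ → Series
thetaTerm m j = const (altSign (j + m)) ⊛ q^ sq ∣ j - m ∣

theta : ℕ → Series
theta m = ΣS (suc (m + m)) (thetaTerm m)

altSign-double : ∀ x y → altSign (x + (x + y)) ≡ altSign y
altSign-double zero    y = refl
altSign-double (suc x) y =
  trans (cong (λ z → - altSign z) (ℕP.+-suc x (x + y))) (trans (ℤP.neg-involutive _) (altSign-double x y))

-- Pairing n with -n:  theta m = 1 + 2 Σ_{i < m} (-1)^(i+1) q^((i+1)²).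
theta-symmetric : ∀ m → theta m ≋ 𝟙 ⊕ const (+ 2) ⊛ ΣS m squareTerm
theta-symmetric m =
  begin≋
    ΣS (suc (m + m)) (thetaTerm m)
  ≈⟨ ≋-reflexive (cong (λ x → ΣS x (thetaTerm m)) (sym (ℕP.+-suc m m))) ⟩
    ΣS (m + suc m) (thetaTerm m)
  ≈⟨ ΣS-split m (suc m) (thetaTerm m) ⟩
    ΣS m (thetaTerm m) ⊕ (thetaTerm m (m + 0) ⊕ ΣS m (λ i → thetaTerm m (m + suc i)))
  ≈⟨ ⊕-cong (≋-trans (ΣS-reverse m (thetaTerm m)) (ΣS-cong m negative))
            (⊕-cong centre (ΣS-cong m (λ i _ → positive i))) ⟩
    ΣS m squareTerm ⊕ (𝟙 ⊕ ΣS m squareTerm)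
  ≈⟨ solve 1 (λ a → a :+ (con 1ℤ :+ a) := con 1ℤ :+ con (+ 2) :* a) ≋-refl (ΣS m squareTerm) ⟩
    𝟙 ⊕ const (+ 2) ⊛ ΣS m squareTerm
  ∎≋
  where
  distance-above : ∀ i → ∣ m + i - m ∣ ≡ i
  distance-above i = trans (ℕP.m≤n⇒∣n-m∣≡n∸m (ℕP.m≤m+n m i)) (ℕP.m+n∸m≡n m i)
  sign-above : ∀ i → altSign (m + i + m) ≡ altSign i
  sign-above i = trans (cong altSign (trans (ℕP.+-assoc m i m) (cong (_+_ m) (ℕP.+-comm i m)))) (altSign-double m i)
  positive : ∀ i → thetaTerm m (m + suc i) ≋ squareTerm i
  positive i = ⊛-cong (const-cong (sign-above (suc i))) (q^-cong (cong sq (distance-above (suc i))))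
  centre : thetaTerm m (m + 0) ≋ 𝟙
  centre = ≋-trans (⊛-cong (const-cong (sign-above 0)) (q^-cong (cong sq (distance-above 0)))) (⊛-identityˡ 𝟙)
  negative : ∀ i → i < m → thetaTerm m (m ∸ suc i) ≋ squareTerm i
  negative i i<m = ⊛-cong (const-cong sign) (q^-cong (cong sq distance))
    where
    x = m ∸ suc i
    distance : ∣ x - m ∣ ≡ suc i
    distance = trans (ℕP.m≤n⇒∣m-n∣≡n∸m (ℕP.m∸n≤m m (suc i))) (ℕP.m∸[m∸n]≡n i<m)
    sign : altSign (x + m) ≡ altSign (suc i)
    sign = trans (cong (λ z → altSign (x + z)) (sym (ℕP.m∸n+n≡m i<m))) (altSign-double x (suc i))

∣j-m∣≤m : ∀ m j → j ≤ m + m → ∣ j - m ∣ ≤ m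
∣j-m∣≤m m j j≤2m with ℕP.≤-total j m
... | inj₁ j≤m = ℕP.≤-trans (ℕP.≤-reflexive (ℕP.m≤n⇒∣m-n∣≡n∸m j≤m)) (ℕP.m∸n≤m m j)
... | inj₂ m≤j = ℕP.≤-trans (ℕP.≤-reflexive (ℕP.m≤n⇒∣n-m∣≡n∸m m≤j))
                            (subst (j ∸ m ≤_) (ℕP.m+n∸m≡n m m) (ℕP.∸-monoˡ-≤ m j≤2m))

-- For j ≤ 2m, both (q²;q²)_j and (q²;q²)_(2m-j) agree with (q²;q²)_m below
-- q^(2(μ+1)), where μ = min(j, 2m-j) = m - |j - m|.
poch²-pair : ∀ m j → j ≤ m + m →
  poch² m ⊛ poch² m ≈[ 2 * suc (m ∸ ∣ j - m ∣) ] poch² j ⊛ poch² (m + m ∸ j)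
poch²-pair m j j≤2m with ℕP.≤-total j m
... | inj₁ j≤m = subst (λ μ → poch² m ⊛ poch² m ≈[ 2 * suc μ ] poch² j ⊛ poch² (m + m ∸ j)) (sym μ≡j) (≈-⊛ near far)
  where
  μ≡j : m ∸ ∣ j - m ∣ ≡ j
  μ≡j = trans (cong (m ∸_) (ℕP.m≤n⇒∣m-n∣≡n∸m j≤m)) (ℕP.m∸[m∸n]≡n j≤m)
  near : poch² m ≈[ 2 * suc j ] poch² j
  near = subst (λ M → poch² M ≈[ 2 * suc j ] poch² j) (ℕP.m+[n∸m]≡n j≤m) (poch²-approx j (m ∸ j))
  far : poch² m ≈[ 2 * suc j ] poch² (m + m ∸ j)
  far = ≈-weaken (2 * suc j) (ℕP.*-monoʳ-≤ 2 (s≤s j≤m))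
          (≈-sym (subst (λ M → poch² M ≈[ 2 * suc m ] poch² m) (sym (ℕP.+-∸-assoc m j≤m)) (poch²-approx m (m ∸ j))))
... | inj₂ m≤j = subst (λ μ → poch² m ⊛ poch² m ≈[ 2 * suc μ ] poch² j ⊛ poch² (m + m ∸ j)) (sym μ≡) (≈-⊛ near far)
  where
  t = j ∸ m
  t≤m : t ≤ m
  t≤m = subst (t ≤_) (ℕP.m+n∸m≡n m m) (ℕP.∸-monoˡ-≤ m j≤2m)
  μ≡ : m ∸ ∣ j - m ∣ ≡ m ∸ t
  μ≡ = cong (m ∸_) (ℕP.m≤n⇒∣n-m∣≡n∸m m≤j)
  near : poch² m ≈[ 2 * suc (m ∸ t) ] poch² j
  near = ≈-weaken (2 * suc (m ∸ t)) (ℕP.*-monoʳ-≤ 2 (s≤s (ℕP.m∸n≤m m t)))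
           (≈-sym (subst (λ M → poch² M ≈[ 2 * suc m ] poch² m) (ℕP.m+[n∸m]≡n m≤j) (poch²-approx m t)))
  far : poch² m ≈[ 2 * suc (m ∸ t) ] poch² (m + m ∸ j)
  far = subst₂ (λ M M′ → poch² M ≈[ 2 * suc (m ∸ t) ] poch² M′)
               (ℕP.m∸n+n≡m t≤m)
               (sym (trans (cong (m + m ∸_) (sym (ℕP.m+[n∸m]≡n m≤j))) (ℕP.[m+n]∸[m+o]≡n∸o m m t)))
               (poch²-approx (m ∸ t) t)

precision : ∀ d μ → suc (d + μ) ≤ sq d + 2 * suc μ
precision d μ =
  ℕP.≤-trans (s≤s (ℕP.+-monoˡ-≤ μ (d≤d²+1 d)))
             (subst (suc (sq d + 1 + μ) ≤_) (sym (rearrange (sq d) μ)) (ℕP.m≤m+n _ μ))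
  where
  d≤d²+1 : ∀ d → d ≤ sq d + 1
  d≤d²+1 zero    = z≤n
  d≤d²+1 (suc d) = ℕP.≤-trans (ℕP.m≤m*n (suc d) (suc d)) (ℕP.m≤m+n _ 1)
  rearrange : ∀ s μ → s + 2 * suc μ ≡ suc (s + 1 + μ) + μ
  rearrange = ℕSolver.solve-∀

-- Multiplying the finite Jacobi sum for N = 2m, b = m by (q²;q²)_m² turns
-- each term into (q²;q²)_(2m) times the corresponding theta term, up to
-- q^(m+1): the binomial coefficient is (q²;q²)_(2m) / ((q²;q²)_j (q²;q²)_(2m-j)),
-- and the error is pushed up by the factor q^((j-m)²).
jacobiTerm-approx : ∀ m j → j ≤ m + m →
  poch² m ⊛ poch² m ⊛ jacobiTerm (m + m) m j ≈[ suc m ] poch² (m + m) ⊛ thetaTerm m j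
jacobiTerm-approx m j j≤2m =
  ≈-weaken (suc m) bound
    (≈-trans (≋⇒≈ _ (solve 5 (λ p p′ c x b → p :* p′ :* (c :* x :* b) := c :* (x :* (p :* p′ :* b))) ≋-refl
                             (poch² m) (poch² m) C Q B))
    (≈-trans (≈-⊛ (≈-refl {const (altSign (j + m))}) (≈-q^ (sq d) binomial-approx))
             (≋⇒≈ _ (solve 3 (λ c x r → c :* (x :* r) := r :* (c :* x)) ≋-refl C Q (poch² (m + m))))))
  where
  d = ∣ j - m ∣
  C = const (altSign (j + m))
  Q = q^ sq d
  B = gbinom (m + m) j
  product : B ⊛ poch² j ⊛ poch² (m + m ∸ j) ≋ poch² (m + m)
  product = subst (λ N → gbinom N j ⊛ poch² j ⊛ poch² (m + m ∸ j) ≋ poch² N)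
                  (ℕP.m+[n∸m]≡n j≤2m) (gbinom-product j (m + m ∸ j))
  binomial-approx : poch² m ⊛ poch² m ⊛ B ≈[ 2 * suc (m ∸ d) ] poch² (m + m)
  binomial-approx =
    ≈-trans (≈-⊛ (poch²-pair m j j≤2m) (≈-refl {B}))
            (≋⇒≈ _ (≋-trans (solve 3 (λ a b g → a :* b :* g := g :* a :* b) ≋-refl (poch² j) (poch² (m + m ∸ j)) B) product))
  bound : suc m ≤ sq d + 2 * suc (m ∸ d)
  bound = subst (λ x → suc x ≤ sq d + 2 * suc (m ∸ d)) (ℕP.m+[n∸m]≡n (∣j-m∣≤m m j j≤2m)) (precision d (m ∸ d))

theta≈φ₋ : ∀ m → theta m ≈[ suc m ] φ₋
theta≈φ₋ m = ≈-trans (≋⇒≈ _ (theta-symmetric m)) (≈-⊕ (≈-refl {𝟙}) (≈-⊛ (≈-refl {const (+ 2)}) (A-partial m)))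

-- Gauss's identity up to q^(m+1):  F_(2m) φ(-q) ≡ 1.  Multiplying the finite
-- Jacobi identity for a = b = m by (q²;q²)_m² gives
--   (q;q)_(2m)² = (q;q²)_m² (q²;q²)_m² ≡ (q²;q²)_(2m) φ(-q) = (q;q)_(2m) (-q;q)_(2m) φ(-q),
-- and (q;q)_(2m) F_(2m) = (-q;q)_(2m); cancel (q;q)_(2m), then (-q;q)_(2m).
gauss-truncated : ∀ m → 𝟙 ≈[ suc m ] F (m + m) ⊛ φ₋
gauss-truncated m =
  cancel-below (pochPlus N) 𝟙 (F N ⊛ φ₋) (pochPlus-at-0 N)
    (≈-trans (≋⇒≈ _ (≋-trans (⊛-identityʳ (pochPlus N)) (≋-sym (F-product N))))
    (≈-trans (≈-⊛ (≈-refl {F N}) poch≈pochPlusφ₋)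
             (≋⇒≈ _ (solve 3 (λ f p φ → f :* (p :* φ) := p :* (f :* φ)) ≋-refl (F N) (pochPlus N) φ₋))))
  where
  N = m + m
  jacobi-approx : poch² m ⊛ poch² m ⊛ jacobiSum N m ≈[ suc m ] poch² N ⊛ theta m
  jacobi-approx =
    ≈-trans (≋⇒≈ _ (ΣS-⊛ (suc N) (poch² m ⊛ poch² m) (jacobiTerm N m)))
    (≈-trans (≈-ΣS (suc N) (λ j j≤N → jacobiTerm-approx m j (ℕP.≤-pred j≤N)))
             (≋⇒≈ _ (≋-sym (ΣS-⊛ (suc N) (poch² N) (thetaTerm m)))))
  squares : poch N ⊛ poch N ≈[ suc m ] poch N ⊛ (pochPlus N ⊛ φ₋)
  squares =
    ≈-trans (≋⇒≈ _ (≋-trans (⊛-cong (poch-evenOdd m) (poch-evenOdd m))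
                   (≋-trans (solve 2 (λ o p → o :* p :* (o :* p) := p :* p :* (o :* o)) ≋-refl (pochOdd m) (poch² m))
                            (⊛-cong (≋-refl {poch² m ⊛ poch² m}) (≋-sym (finite-jacobi m m))))))
    (≈-trans jacobi-approx
    (≈-trans (≈-⊛ (≈-refl {poch² N}) (theta≈φ₋ m))
             (≋⇒≈ _ (≋-trans (⊛-cong (poch²-split N) (≋-refl {φ₋})) (⊛-assoc (poch N) (pochPlus N) φ₋)))))
  poch≈pochPlusφ₋ : poch N ≈[ suc m ] pochPlus N ⊛ φ₋
  poch≈pochPlusφ₋ = cancel-below (poch N) (poch N) (pochPlus N ⊛ φ₋) (poch-at-0 N) squares

P̄ : Series
P̄ n = + pbar n

gauss : P̄ ⊛ φ₋ ≋ 𝟙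
gauss = pt λ n → sym (trans (below (gauss-truncated n) n ℕP.≤-refl)
                             (below (≈-⊛ (F≈P̄ n) (≈-refl {φ₋})) n ℕP.≤-refl))
  where
  F≈P̄ : ∀ n → F (n + n) ≈[ suc n ] P̄
  F≈P̄ n = agree (λ k k≤n → F-stable (n + n) k (ℕP.≤-trans (ℕP.≤-pred k≤n) (ℕP.m≤m+n n n)))

infix 4 _≅_mod_
record _≅_mod_ (f g : Series) (c : ℤ) : Set where
  constructor congruent
  field
    quotient   : Series
    difference : f ≋ g ⊕ const c ⊛ quotient

≋⇒≅mod : ∀ {f g} c → f ≋ g → f ≅ g mod c
≋⇒≅mod {g = g} c f≋g =
  congruent (const 0ℤ) (≋-trans f≋g (solve 2 (λ g m → g := g :+ m :* con 0ℤ) ≋-refl g (const c)))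

≅mod-trans : ∀ {f g h c} → f ≅ g mod c → g ≅ h mod c → f ≅ h mod c
≅mod-trans {h = h} {c} (congruent F f≅g) (congruent G g≅h) =
  congruent (F ⊕ G) (≋-trans f≅g (≋-trans (⊕-cong g≅h ≋-refl)
    (solve 4 (λ h m f g → h :+ m :* g :+ m :* f := h :+ m :* (f :+ g)) ≋-refl h (const c) F G)))

≅mod-⊛ : ∀ {f f′ g g′ c} → f ≅ f′ mod c → g ≅ g′ mod c → f ⊛ g ≅ f′ ⊛ g′ mod c
≅mod-⊛ {f′ = f′} {g′ = g′} {c} (congruent F f≅f′) (congruent G g≅g′) =
  congruent (F ⊛ g′ ⊕ f′ ⊛ G ⊕ const c ⊛ F ⊛ G)
    (≋-trans (⊛-cong f≅f′ g≅g′)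
      (solve 5 (λ f g m F G → (f :+ m :* F) :* (g :+ m :* G) := f :* g :+ m :* (F :* g :+ f :* G :+ m :* F :* G))
             ≋-refl f′ g′ (const c) F G))

K : ℕ → Series
K k n = + pbarK k n

K-zero : K 0 ≋ 𝟙
K-zero = pt λ { zero → refl ; (suc n) → refl }

K-suc : ∀ k → K (suc k) ≋ P̄ ⊛ K k
K-suc k = pt λ n → trans (sum-upTo (suc n) (λ i → pbar i * pbarK k (n ∸ i)))
                         (Σ<-cong′ (suc n) (λ i → ℤP.pos-* (pbar i) (pbarK k (n ∸ i))))

-- The binomial coefficients C(k+1, 2) and C(k+2, 3).
triangular : ℕ → ℕ
triangular zero    = 0
triangular (suc k) = triangular k + suc k

tetrahedral : ℕ → ℕ
tetrahedral zero    = 0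
tetrahedral (suc k) = tetrahedral k + triangular (suc k)

-- The binomial series (1 + 2A)⁻ᵏ = Σ_j C(-k, j) 2ʲ Aʲ cut off after j = 3:
--   1 - 2k A + 4 C(k+1,2) A² - 8 C(k+2,3) A³.
expansion : ℕ → Series
expansion k = 𝟙 ⊕ ⊝ (const (+ 2) ⊛ const (+ k) ⊛ A)
                ⊕ const (+ 4) ⊛ const (+ triangular k) ⊛ (A ⊛ A)
                ⊕ ⊝ (const (+ 8) ⊛ const (+ tetrahedral k) ⊛ (A ⊛ A ⊛ A))

-- P̄ = 1/(1 + 2A) ≡ 1 - 2A + 4A² - 8A³ (mod 16), because
-- (1 + 2A)(1 - 2A + 4A² - 8A³) = 1 - 16A⁴.
P̄-expansion : P̄ ≅ expansion 1 mod + 16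
P̄-expansion = congruent (P̄ ⊛ (A ⊛ A ⊛ A ⊛ A))
  (begin≋
    P̄
  ≈⟨ solve 2 (λ p a → p := t₁ a :+ con (+ 16) :* (p :* (a :* a :* a :* a))
                          :+ t₁ a :* (p :* (con 1ℤ :+ con (+ 2) :* a) :- con 1ℤ)) ≋-refl P̄ A ⟩
    expansion 1 ⊕ const (+ 16) ⊛ (P̄ ⊛ (A ⊛ A ⊛ A ⊛ A)) ⊕ expansion 1 ⊛ (P̄ ⊛ φ₋ ⊕ ⊝ 𝟙)
  ≈⟨ ⊕-cong (≋-refl {expansion 1 ⊕ const (+ 16) ⊛ (P̄ ⊛ (A ⊛ A ⊛ A ⊛ A))})
            (⊛-cong (≋-refl {expansion 1}) (⊕-cong gauss (≋-refl {⊝ 𝟙}))) ⟩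
    expansion 1 ⊕ const (+ 16) ⊛ (P̄ ⊛ (A ⊛ A ⊛ A ⊛ A)) ⊕ expansion 1 ⊛ (𝟙 ⊕ ⊝ 𝟙)
  ≈⟨ solve 2 (λ x t → x :+ t :* (con 1ℤ :- con 1ℤ) := x) ≋-refl
           (expansion 1 ⊕ const (+ 16) ⊛ (P̄ ⊛ (A ⊛ A ⊛ A ⊛ A))) (expansion 1) ⟩
    expansion 1 ⊕ const (+ 16) ⊛ (P̄ ⊛ (A ⊛ A ⊛ A ⊛ A))
  ∎≋)
  where
  t₁ : ∀ {n} → Polynomial n → Polynomial n
  t₁ a = con 1ℤ :- con (+ 2) :* con (+ 1) :* a :+ con (+ 4) :* con (+ 1) :* (a :* a)
         :- con (+ 8) :* con (+ 1) :* (a :* a :* a)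

const-+ : ∀ a b → const (+ (a + b)) ≋ const (+ a) ⊕ const (+ b)
const-+ a b = pt λ { zero → ℤP.pos-+ a b ; (suc _) → refl }

-- Multiplying the truncated binomial series for k by the one for 1 gives
-- the one for k + 1, up to multiples of 16 (Pascal's rule for the coefficients).
expansion-suc : ∀ k → expansion 1 ⊛ expansion k ≅ expansion (suc k) mod + 16
expansion-suc k = congruent W (≋-trans
  (solve 4 (λ a k′ d e → t 1# 1# 1# a :* t k′ d e a
                          := t (1# :+ k′) (d :+ (1# :+ k′)) (e :+ (d :+ (1# :+ k′))) a
                             :+ con (+ 16) :* ((e :+ d :+ k′) :* (a :* a :* a :* a)
                                              :- con (+ 2) :* (e :+ d) :* (a :* a :* a :* a :* a)
                                              :+ con (+ 4) :* e :* (a :* a :* a :* a :* a :* a)))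
           ≋-refl A Kc Dc Ec)
  (⊕-cong (≋-sym coefficients) (≋-refl {const (+ 16) ⊛ W})))
  where
  Kc = const (+ k)
  Dc = const (+ triangular k)
  Ec = const (+ tetrahedral k)
  W = (Ec ⊕ Dc ⊕ Kc) ⊛ (A ⊛ A ⊛ A ⊛ A) ⊕ ⊝ (const (+ 2) ⊛ (Ec ⊕ Dc) ⊛ (A ⊛ A ⊛ A ⊛ A ⊛ A))
      ⊕ const (+ 4) ⊛ Ec ⊛ (A ⊛ A ⊛ A ⊛ A ⊛ A ⊛ A)
  1# : ∀ {n} → Polynomial n
  1# = con 1ℤ
  t : ∀ {n} → Polynomial n → Polynomial n → Polynomial n → Polynomial n → Polynomial n
  t k′ d e a = 1# :- con (+ 2) :* k′ :* a :+ con (+ 4) :* d :* (a :* a) :- con (+ 8) :* e :* (a :* a :* a)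
  suc≋ : const (+ suc k) ≋ 𝟙 ⊕ Kc
  suc≋ = const-+ 1 k
  triangular≋ : const (+ triangular (suc k)) ≋ Dc ⊕ (𝟙 ⊕ Kc)
  triangular≋ = ≋-trans (const-+ (triangular k) (suc k)) (⊕-cong (≋-refl {Dc}) suc≋)
  tetrahedral≋ : const (+ tetrahedral (suc k)) ≋ Ec ⊕ (Dc ⊕ (𝟙 ⊕ Kc))
  tetrahedral≋ = ≋-trans (const-+ (tetrahedral k) (triangular (suc k))) (⊕-cong (≋-refl {Ec}) triangular≋)
  coefficients : expansion (suc k) ≋ 𝟙 ⊕ ⊝ (const (+ 2) ⊛ (𝟙 ⊕ Kc) ⊛ A) ⊕ const (+ 4) ⊛ (Dc ⊕ (𝟙 ⊕ Kc)) ⊛ (A ⊛ A)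
                                     ⊕ ⊝ (const (+ 8) ⊛ (Ec ⊕ (Dc ⊕ (𝟙 ⊕ Kc))) ⊛ (A ⊛ A ⊛ A))
  coefficients =
    ⊕-cong (⊕-cong (⊕-cong (≋-refl {𝟙}) (⊝-cong (⊛-cong (⊛-cong (≋-refl {const (+ 2)}) suc≋) (≋-refl {A}))))
                   (⊛-cong (⊛-cong (≋-refl {const (+ 4)}) triangular≋) (≋-refl {A ⊛ A})))
           (⊝-cong (⊛-cong (⊛-cong (≋-refl {const (+ 8)}) tetrahedral≋) (≋-refl {A ⊛ A ⊛ A})))

K-expansion : ∀ k → K k ≅ expansion k mod + 16
K-expansion zero =
  ≋⇒≅mod (+ 16) (≋-trans K-zero
    (solve 1 (λ a → con 1ℤ := con 1ℤ :- con (+ 2) :* con 0ℤ :* a :+ con (+ 4) :* con 0ℤ :* (a :* a)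
                              :- con (+ 8) :* con 0ℤ :* (a :* a :* a)) ≋-refl A))
K-expansion (suc k) =
  ≅mod-trans (≋⇒≅mod (+ 16) (K-suc k))
    (≅mod-trans (≅mod-⊛ P̄-expansion (K-expansion k)) (expansion-suc k))

parity : ∀ x → ∃ λ y → x ≡ 2 * y ⊎ x ≡ suc (2 * y)
parity zero = 0 , inj₁ refl
parity (suc x) with parity x
... | y , inj₁ x≡2y   = y , inj₂ (cong suc x≡2y)
... | y , inj₂ x≡2y+1 = suc y , inj₁ (trans (cong suc x≡2y+1) (cong suc (sym (ℕP.+-suc y (y + 0)))))

square-injective : ∀ a b → a * a ≡ b * b → a ≡ b
square-injective a b a²≡b² with ℕP.<-cmp a b
... | tri< a<b _ _ = ⊥-elim (ℕP.<-irrefl a²≡b² (ℕP.*-mono-< a<b a<b))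
... | tri≈ _ a≡b _ = a≡b
... | tri> _ _ b<a = ⊥-elim (ℕP.<-irrefl (sym a²≡b²) (ℕP.*-mono-< b<a b<a))

odd-square : ∀ x → suc (2 * x) * suc (2 * x) ≡ suc (2 * (2 * (x * x) + 2 * x))
odd-square = ℕSolver.solve-∀

even-square : ∀ x → 2 * x * (2 * x) ≡ 2 * (2 * (x * x))
even-square = ℕSolver.solve-∀

odd-square≢twice : ∀ x y → suc (2 * x) * suc (2 * x) ≢ 2 * (y * y)
odd-square≢twice x y eq = ℕP.even≢odd (y * y) (2 * (x * x) + 2 * x) (sym (trans (sym (odd-square x)) eq))

square≢twice-square : ∀ y → 0 < y → ∀ x → x * x ≢ 2 * (y * y)
square≢twice-square = <-rec (λ y → 0 < y → ∀ x → x * x ≢ 2 * (y * y)) descent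
  where
  descent : ∀ y → (∀ {y′} → y′ < y → 0 < y′ → ∀ x → x * x ≢ 2 * (y′ * y′)) → 0 < y → ∀ x → x * x ≢ 2 * (y * y)
  descent y smaller 0<y x eq with parity x
  ... | x′ , inj₂ refl = odd-square≢twice x′ y eq
  ... | x′ , inj₁ refl with parity y
  ...   | y′ , inj₂ refl = odd-square≢twice y′ x′ y²≡2x′²
    where
    y²≡2x′² : suc (2 * y′) * suc (2 * y′) ≡ 2 * (x′ * x′)
    y²≡2x′² = ℕP.*-cancelˡ-≡ _ _ 2 (trans (sym eq) (even-square x′))
  ...   | y′ , inj₁ refl = smaller y′<y 0<y′ x′ x′²≡2y′²
    where
    0<y′ : 0 < y′
    0<y′ = ℕP.n≢0⇒n>0 (λ { refl → ℕP.<-irrefl refl 0<y })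
    y′<y : y′ < 2 * y′
    y′<y = subst (y′ <_) (cong (_+_ y′) (sym (ℕP.+-identityʳ y′))) (ℕP.m<m+n y′ 0<y′)
    x′²≡2y′² : x′ * x′ ≡ 2 * (y′ * y′)
    x′²≡2y′² = ℕP.*-cancelˡ-≡ _ _ 2 (ℕP.*-cancelˡ-≡ _ _ 2
      (trans (sym (even-square x′)) (trans eq (cong (2 *_) (even-square y′)))))

square-not-twice : ∀ n x → 1 ≤ n → n ≡ x * x → ¬ (∃ λ y → n ≡ 2 * (y * y))
square-not-twice n x 1≤n n≡x² (zero  , n≡0) = ℕP.<-irrefl (sym n≡0) 1≤n
square-not-twice n x 1≤n n≡x² (suc y , n≡2y²) = square≢twice-square (suc y) (s≤s z≤n) x (trans (sym n≡x²) n≡2y²)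

square? : ∀ t → Dec (∃ λ j → t ≡ j * j)
square? t with ℕP.anyUpTo? (λ j → t ℕP.≟ j * j) (suc t)
... | yes (j , _ , t≡j²) = yes (j , t≡j²)
... | no ¬bounded = no λ { (j , t≡j²) → ¬bounded (j , s≤s (root≤ j t≡j²) , t≡j²) }
  where
  root≤ : ∀ j → t ≡ j * j → j ≤ t
  root≤ zero    _    = z≤n
  root≤ (suc j) t≡j² = subst (suc j ≤_) (sym t≡j²) (ℕP.m≤m*n (suc j) (suc j))

squareTerm-at : ∀ i n → squareTerm i n ≡ altSign (suc i) *ℤ (q^ sq (suc i)) n
squareTerm-at i n = const-⊛ (altSign (suc i)) (q^ sq (suc i)) n

A-at-square : ∀ j → A (sq (suc j)) ≡ altSign (suc j)
A-at-square j =
  trans (Σ<-single (sq (suc j)) (λ i → squareTerm i (sq (suc j))) j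
                   (ℕP.<-≤-trans (ℕP.n<1+n j) (ℕP.m≤m*n (suc j) (suc j))) otherTerms)
        (trans (squareTerm-at j (sq (suc j)))
               (trans (cong (altSign (suc j) *ℤ_) (q^-diagonal (sq (suc j)))) (ℤP.*-identityʳ _)))
  where
  otherTerms : ∀ i → i ≢ j → squareTerm i (sq (suc j)) ≡ 0ℤ
  otherTerms i i≢j =
    trans (squareTerm-at i (sq (suc j)))
          (trans (cong (altSign (suc i) *ℤ_)
                       (q^-offDiagonal (sq (suc i)) (sq (suc j)) (i≢j ∘ ℕP.suc-injective ∘ square-injective (suc i) (suc j))))
                 (ℤP.*-zeroʳ (altSign (suc i))))

A-at-positiveSquare : ∀ n x → 1 ≤ n → n ≡ x * x → A n ≡ altSign x
A-at-positiveSquare n zero    1≤n n≡0  = ⊥-elim (ℕP.<-irrefl (sym n≡0) 1≤n)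
A-at-positiveSquare n (suc x) _   refl = A-at-square x

A-at-nonSquare : ∀ n → ¬ (∃ λ j → n ≡ j * j) → A n ≡ 0ℤ
A-at-nonSquare n nonSquare = Σ<-vanish n (λ i → squareTerm i n) λ i →
  trans (squareTerm-at i n)
        (trans (cong (altSign (suc i) *ℤ_) (q^-offDiagonal (sq (suc i)) n (λ eq → nonSquare (suc i , sym eq))))
               (ℤP.*-zeroʳ (altSign (suc i))))

altSign² : ∀ j → altSign j *ℤ altSign j ≡ 1ℤ
altSign² zero    = refl
altSign² (suc j) = trans (neg*neg (altSign j)) (altSign² j)
  where
  neg*neg : ∀ x → (- x) *ℤ (- x) ≡ x *ℤ x
  neg*neg = solve-∀

-- In a self-product f ⊛ f the terms f i f (n-i) and f (n-i) f i pair up, so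
-- its coefficients are even except for the middle term f(n/2)² when n is even.
-- selfSum f a m is the part of such a coefficient lying between f a and f (a+m).
selfSum : (ℕ → ℤ) → ℕ → ℕ → ℤ
selfSum f a m = Σ< (suc m) (λ i → f (a + i) *ℤ f (a + (m ∸ i)))

selfSum-peel : ∀ f a m → selfSum f a (suc (suc m)) ≡ + 2 *ℤ (f (a + 0) *ℤ f (a + suc (suc m))) +ℤ selfSum f (suc a) m
selfSum-peel f a m =
  begin
    g 0 +ℤ Σ< (suc (suc m)) (g ∘ suc)
  ≡⟨ cong (g 0 +ℤ_) (Σ<-last (suc m) (g ∘ suc)) ⟩
    g 0 +ℤ (Σ< (suc m) (g ∘ suc) +ℤ g (suc (suc m)))
  ≡⟨ cong₂ (λ x y → g 0 +ℤ (x +ℤ f (a + suc (suc m)) *ℤ f (a + y)))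
           (Σ<-cong (suc m) (λ i i≤m → inner i (ℕP.≤-pred i≤m))) (ℕP.n∸n≡0 m) ⟩
    g 0 +ℤ (selfSum f (suc a) m +ℤ f (a + suc (suc m)) *ℤ f (a + 0))
  ≡⟨ regroup (f (a + 0)) (f (a + suc (suc m))) (selfSum f (suc a) m) ⟩
    + 2 *ℤ (f (a + 0) *ℤ f (a + suc (suc m))) +ℤ selfSum f (suc a) m
  ∎
  where
  open ≡-Reasoning
  g : ℕ → ℤ
  g i = f (a + i) *ℤ f (a + (suc (suc m) ∸ i))
  inner : ∀ i → i ≤ m → g (suc i) ≡ f (suc a + i) *ℤ f (suc a + (m ∸ i))
  inner i i≤m = cong₂ _*ℤ_ (cong f (ℕP.+-suc a i))
                           (cong f (trans (cong (_+_ a) (ℕP.+-∸-assoc 1 i≤m)) (ℕP.+-suc a (m ∸ i))))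
  regroup : ∀ x y s → x *ℤ y +ℤ (s +ℤ y *ℤ x) ≡ + 2 *ℤ (x *ℤ y) +ℤ s
  regroup = solve-∀

selfSum-even : ∀ f t a → Σ ℤ (λ R → selfSum f a (t + t) ≡ f (a + t) *ℤ f (a + t) +ℤ + 2 *ℤ R)
selfSum-even f zero    a = 0ℤ , refl
selfSum-even f (suc t) a with selfSum-even f t (suc a)
... | R , eq = f (a + 0) *ℤ f (a + suc (suc (t + t))) +ℤ R ,
  (begin
    selfSum f a (suc t + suc t)
  ≡⟨ cong (λ x → selfSum f a (suc x)) (ℕP.+-suc t t) ⟩
    selfSum f a (suc (suc (t + t)))
  ≡⟨ selfSum-peel f a (t + t) ⟩
    + 2 *ℤ P +ℤ selfSum f (suc a) (t + t)
  ≡⟨ cong (+ 2 *ℤ P +ℤ_) eq ⟩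
    + 2 *ℤ P +ℤ (f (suc a + t) *ℤ f (suc a + t) +ℤ + 2 *ℤ R)
  ≡⟨ cong (λ x → + 2 *ℤ P +ℤ (f x *ℤ f x +ℤ + 2 *ℤ R)) (sym (ℕP.+-suc a t)) ⟩
    + 2 *ℤ P +ℤ (f (a + suc t) *ℤ f (a + suc t) +ℤ + 2 *ℤ R)
  ≡⟨ regroup P (f (a + suc t)) R ⟩
    f (a + suc t) *ℤ f (a + suc t) +ℤ + 2 *ℤ (P +ℤ R)
  ∎)
  where
  open ≡-Reasoning
  P = f (a + 0) *ℤ f (a + suc (suc (t + t)))
  regroup : ∀ p x r → + 2 *ℤ p +ℤ (x *ℤ x +ℤ + 2 *ℤ r) ≡ x *ℤ x +ℤ + 2 *ℤ (p +ℤ r)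
  regroup = solve-∀

selfSum-odd : ∀ f t a → Σ ℤ (λ R → selfSum f a (suc (t + t)) ≡ + 2 *ℤ R)
selfSum-odd f zero    a = f (a + 0) *ℤ f (a + 1) , pair (f (a + 0)) (f (a + 1))
  where
  pair : ∀ x y → x *ℤ y +ℤ (y *ℤ x +ℤ 0ℤ) ≡ + 2 *ℤ (x *ℤ y)
  pair = solve-∀
selfSum-odd f (suc t) a with selfSum-odd f t (suc a)
... | R , eq = f (a + 0) *ℤ f (a + suc (suc (suc (t + t)))) +ℤ R ,
  trans (cong (λ x → selfSum f a (suc (suc x))) (ℕP.+-suc t t))
        (trans (selfSum-peel f a (suc (t + t)))
               (trans (cong (+ 2 *ℤ (f (a + 0) *ℤ f (a + suc (suc (suc (t + t))))) +ℤ_) eq)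
                      (sym (ℤP.*-distribˡ-+ (+ 2) (f (a + 0) *ℤ f (a + suc (suc (suc (t + t))))) R))))

A²-at-twiceSquare : ∀ j → Σ ℤ (λ R → (A ⊛ A) (2 * (suc j * suc j)) ≡ 1ℤ +ℤ + 2 *ℤ R)
A²-at-twiceSquare j with selfSum-even A (sq (suc j)) 0
... | R , eq = R , trans (cong (selfSum A 0) (twice (sq (suc j))))
                         (trans eq (cong (_+ℤ + 2 *ℤ R) (trans (cong (λ x → x *ℤ x) (A-at-square j)) (altSign² (suc j)))))

A²-at-otherwise : ∀ n → ¬ (∃ λ j → n ≡ 2 * (j * j)) → Σ ℤ (λ R → (A ⊛ A) n ≡ 0ℤ +ℤ + 2 *ℤ R)
A²-at-otherwise n notTwice with parity n
... | t , inj₂ refl with selfSum-odd A t 0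
...   | R , eq = R , trans (cong (λ x → selfSum A 0 (suc x)) (twice t)) (trans eq (sym (ℤP.+-identityˡ _)))
A²-at-otherwise n notTwice | t , inj₁ refl with square? t
... | yes (j , t≡j²) = ⊥-elim (notTwice (j , cong (2 *_) t≡j²))
... | no nonSquare with selfSum-even A t 0
...   | R , eq = R , trans (cong (selfSum A 0) (twice t))
                           (trans eq (cong (λ x → x *ℤ x +ℤ + 2 *ℤ R) (A-at-nonSquare t nonSquare)))

mk-periodic : ∀ k → mk (4 + k) ≡ mk k
mk-periodic k = cong mk-aux (trans (cong (_% 4) (ℕP.+-comm 4 k)) (ℕDM.[m+n]%n≡m%n k 4))

triangular-periodic : ∀ k → triangular (4 + k) ≡ triangular k + 2 * (2 * k + 5)
triangular-periodic k = lemma (triangular k) k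
  where
  lemma : ∀ t k → t + suc k + suc (suc k) + suc (suc (suc k)) + suc (suc (suc (suc k))) ≡ t + 2 * (2 * k + 5)
  lemma = ℕSolver.solve-∀

tetrahedral-periodic : ∀ k → tetrahedral (4 + k) ≡ tetrahedral k + 2 * (2 * triangular k + 5 * k + 10)
tetrahedral-periodic k = lemma (tetrahedral k) (triangular k) k
  where
  lemma : ∀ e t k →
    e + (t + suc k) + (t + suc k + suc (suc k)) + (t + suc k + suc (suc k) + suc (suc (suc k)))
      + (t + suc k + suc (suc k) + suc (suc (suc k)) + suc (suc (suc (suc k))))
    ≡ e + 2 * (2 * t + 5 * k + 10)
  lemma = ℕSolver.solve-∀

-- What the proof needs to know about m(k): either 2^m(k) = 8, or
-- 2^m(k) = 16 and the coefficients C(k+1,2) and C(k+2,3) are even.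
data ModulusCase (k : ℕ) : Set where
  eight   : mk k ≡ 3 → ModulusCase k
  sixteen : mk k ≡ 4 → 2 ∣ℕ triangular k → 2 ∣ℕ tetrahedral k → ModulusCase k

modulusCase : ∀ k → ModulusCase k
modulusCase 0 = sixteen refl (divides 0 refl) (divides 0 refl)
modulusCase 1 = eight refl
modulusCase 2 = eight refl
modulusCase 3 = sixteen refl (divides 3 refl) (divides 5 refl)
modulusCase (suc (suc (suc (suc k)))) with modulusCase k
... | eight m≡3 = eight (trans (mk-periodic k) m≡3)
... | sixteen m≡4 2∣t 2∣e =
  sixteen (trans (mk-periodic k) m≡4)
          (subst (2 ∣ℕ_) (sym (triangular-periodic k)) (ℕD.∣m∣n⇒∣m+n 2∣t (ℕD.m∣m*n (2 * k + 5))))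
          (subst (2 ∣ℕ_) (sym (tetrahedral-periodic k)) (ℕD.∣m∣n⇒∣m+n 2∣e (ℕD.m∣m*n (2 * triangular k + 5 * k + 10))))

const-const-⊛ : ∀ a b f n → (const a ⊛ const b ⊛ f) n ≡ a *ℤ b *ℤ f n
const-const-⊛ a b f n =
  trans (at (⊛-assoc (const a) (const b) f) n)
        (trans (const-⊛ a (const b ⊛ f) n)
               (trans (cong (a *ℤ_) (const-⊛ b f n)) (sym (ℤP.*-assoc a b (f n)))))

expansion-at : ∀ k n → expansion k (suc n) ≡
  0ℤ +ℤ - (+ 2 *ℤ + k *ℤ A (suc n)) +ℤ + 4 *ℤ + triangular k *ℤ (A ⊛ A) (suc n)
     +ℤ - (+ 8 *ℤ + tetrahedral k *ℤ (A ⊛ A ⊛ A) (suc n))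
expansion-at k n =
  cong₂ _+ℤ_ (cong₂ _+ℤ_ (cong (λ x → 0ℤ +ℤ - x) (const-const-⊛ (+ 2) (+ k) A (suc n)))
                         (const-const-⊛ (+ 4) (+ triangular k) (A ⊛ A) (suc n)))
             (cong -_ (const-const-⊛ (+ 8) (+ tetrahedral k) (A ⊛ A ⊛ A) (suc n)))

divisible : ∀ c {V} W → V ≡ W *ℤ + c → + c ∣ V
divisible c W V≡W*c = Signed.∣⇒∣ᵤ (Signed.divides W V≡W*c)

pbarK-congruence : ∀ k n → 1 ≤ n → ∀ {s δ} → A n ≡ s → Σ ℤ (λ R → (A ⊛ A) n ≡ δ +ℤ + 2 *ℤ R) →
  + (2 ^ mk k) ∣ + pbarK k n - (- (+ 2 *ℤ + k *ℤ s) +ℤ + 4 *ℤ + triangular k *ℤ δ)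
pbarK-congruence k (suc n) _ {s} {δ} A≡s (R , A²≡δ) with K-expansion k
... | congruent H K≅expansion = reduce (modulusCase k)
  where
  D E a₃ h residue : ℤ
  D = + triangular k
  E = + tetrahedral k
  a₃ = (A ⊛ A ⊛ A) (suc n)
  h = H (suc n)
  residue = - (+ 2 *ℤ + k *ℤ s) +ℤ + 4 *ℤ D *ℤ δ
  coefficient : + pbarK k (suc n) ≡ 0ℤ +ℤ - (+ 2 *ℤ + k *ℤ s) +ℤ + 4 *ℤ D *ℤ (δ +ℤ + 2 *ℤ R) +ℤ - (+ 8 *ℤ E *ℤ a₃) +ℤ + 16 *ℤ h
  coefficient =
    trans (at K≅expansion (suc n))
          (cong₂ _+ℤ_ (trans (expansion-at k n)
                             (cong₂ (λ x y → 0ℤ +ℤ - (+ 2 *ℤ + k *ℤ x) +ℤ + 4 *ℤ D *ℤ y +ℤ - (+ 8 *ℤ E *ℤ a₃)) A≡s A²≡δ))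
                      (const-⊛ (+ 16) H (suc n)))
  difference : + pbarK k (suc n) - residue ≡ (D *ℤ R +ℤ - (E *ℤ a₃) +ℤ + 2 *ℤ h) *ℤ + 8
  difference = trans (cong (_- residue) coefficient) (algebra (+ k) s δ R D E a₃ h)
    where
    algebra : ∀ k s δ R D E a h →
      0ℤ +ℤ - (+ 2 *ℤ k *ℤ s) +ℤ + 4 *ℤ D *ℤ (δ +ℤ + 2 *ℤ R) +ℤ - (+ 8 *ℤ E *ℤ a) +ℤ + 16 *ℤ h
        - (- (+ 2 *ℤ k *ℤ s) +ℤ + 4 *ℤ D *ℤ δ)
      ≡ (D *ℤ R +ℤ - (E *ℤ a) +ℤ + 2 *ℤ h) *ℤ + 8
    algebra = solve-∀
  reduce : ModulusCase k → + (2 ^ mk k) ∣ + pbarK k (suc n) - residue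
  reduce (eight m≡3) rewrite m≡3 = divisible 8 (D *ℤ R +ℤ - (E *ℤ a₃) +ℤ + 2 *ℤ h) difference
  reduce (sixteen m≡4 (divides d t≡d*2) (divides e t≡e*2)) rewrite m≡4 =
    divisible 16 (+ d *ℤ R +ℤ - (+ e *ℤ a₃) +ℤ h)
      (trans difference (trans (cong₂ (λ x y → (x *ℤ R +ℤ - (y *ℤ a₃) +ℤ + 2 *ℤ h) *ℤ + 8)
                                      (trans (cong +_ t≡d*2) (ℤP.pos-* d 2)) (trans (cong +_ t≡e*2) (ℤP.pos-* e 2)))
                               (halve (+ d) (+ e) R a₃ h)))
    where
    halve : ∀ d e R a h → (d *ℤ + 2 *ℤ R +ℤ - (e *ℤ + 2 *ℤ a) +ℤ + 2 *ℤ h) *ℤ + 8 ≡ (d *ℤ R +ℤ - (e *ℤ a) +ℤ h) *ℤ + 16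
    halve = solve-∀

altSign-even : ∀ j → altSign (2 * j) ≡ 1ℤ
altSign-even j = altSign-double j 0

altSign-odd : ∀ j → altSign (2 * j + 1) ≡ - 1ℤ
altSign-odd j = trans (cong altSign (ℕP.+-comm (2 * j) 1)) (cong -_ (altSign-even j))

four-triangular : ∀ k → 4 * triangular k ≡ 2 * k * (k + 1)
four-triangular zero    = refl
four-triangular (suc k) = trans (ℕP.*-distribˡ-+ 4 (triangular k) (suc k))
                                (trans (cong (_+ 4 * suc k) (four-triangular k)) (lemma k))
  where
  lemma : ∀ k → 2 * k * (k + 1) + 4 * suc k ≡ 2 * suc k * (suc k + 1)
  lemma = ℕSolver.solve-∀

at-evenSquare : ∀ k n → n ≥ 1 → (∃ λ j → n ≡ (2 * j) * (2 * j)) → + (2 ^ mk k) ∣ + pbarK k n - - (+ (2 * k))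
at-evenSquare k n n≥1 (j , n≡) =
  subst (λ r → + (2 ^ mk k) ∣ + pbarK k n - r) (trans (residue (+ k) (+ triangular k)) (cong -_ (sym (ℤP.pos-* 2 k))))
        (pbarK-congruence k n n≥1 (trans (A-at-positiveSquare n (2 * j) n≥1 n≡) (altSign-even j))
                                  (A²-at-otherwise n (square-not-twice n (2 * j) n≥1 n≡)))
  where
  residue : ∀ k d → - (+ 2 *ℤ k *ℤ 1ℤ) +ℤ + 4 *ℤ d *ℤ 0ℤ ≡ - (+ 2 *ℤ k)
  residue = solve-∀

at-oddSquare : ∀ k n → n ≥ 1 → (∃ λ j → n ≡ (2 * j + 1) * (2 * j + 1)) → + (2 ^ mk k) ∣ + pbarK k n - + (2 * k)
at-oddSquare k n n≥1 (j , n≡) =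
  subst (λ r → + (2 ^ mk k) ∣ + pbarK k n - r) (trans (residue (+ k) (+ triangular k)) (sym (ℤP.pos-* 2 k)))
        (pbarK-congruence k n n≥1 (trans (A-at-positiveSquare n (2 * j + 1) n≥1 n≡) (altSign-odd j))
                                  (A²-at-otherwise n (square-not-twice n (2 * j + 1) n≥1 n≡)))
  where
  residue : ∀ k d → - (+ 2 *ℤ k *ℤ - 1ℤ) +ℤ + 4 *ℤ d *ℤ 0ℤ ≡ + 2 *ℤ k
  residue = solve-∀

at-twiceSquare : ∀ k n → n ≥ 1 → (∃ λ j → n ≡ 2 * (j * j)) → + (2 ^ mk k) ∣ + pbarK k n - + (2 * k * (k + 1))
at-twiceSquare k n n≥1 (zero  , n≡0)  = ⊥-elim (ℕP.<-irrefl (sym n≡0) n≥1)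
at-twiceSquare k n n≥1 (suc j , refl) =
  subst (λ r → + (2 ^ mk k) ∣ + pbarK k n - r)
        (trans (residue (+ k) (+ triangular k)) (trans (sym (ℤP.pos-* 4 (triangular k))) (cong +_ (four-triangular k))))
        (pbarK-congruence k n n≥1 (A-at-nonSquare n (λ (x , n≡x²) → square-not-twice n x n≥1 n≡x² (suc j , refl)))
                                  (A²-at-twiceSquare j))
  where
  residue : ∀ k d → - (+ 2 *ℤ k *ℤ 0ℤ) +ℤ + 4 *ℤ d *ℤ 1ℤ ≡ + 4 *ℤ d
  residue = solve-∀

at-neither : ∀ k n → n ≥ 1 → ¬ (∃ λ j → n ≡ j * j) → ¬ (∃ λ j → n ≡ 2 * (j * j)) → + (2 ^ mk k) ∣ + pbarK k n
at-neither k n n≥1 nonSquare nonTwice =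
  subst (+ (2 ^ mk k) ∣_) (residue (+ pbarK k n) (+ k) (+ triangular k))
        (pbarK-congruence k n n≥1 (A-at-nonSquare n nonSquare) (A²-at-otherwise n nonTwice))
  where
  residue : ∀ x k d → x - (- (+ 2 *ℤ k *ℤ 0ℤ) +ℤ + 4 *ℤ d *ℤ 0ℤ) ≡ x
  residue = solve-∀

-- Theorem 2.1.
theorem2p1 : (k : ℕ) → k ≥ 1 → (n : ℕ) → n ≥ 1 →
    ((∃ λ j → n ≡ (2 * j) * (2 * j)) →
      (+ (2 ^ mk k)) ∣ ((+ pbarK k n) - (- (+ (2 * k)))))
    × ((∃ λ j → n ≡ (2 * j + 1) * (2 * j + 1)) →
      (+ (2 ^ mk k)) ∣ ((+ pbarK k n) - (+ (2 * k))))
    × ((∃ λ j → n ≡ 2 * (j * j)) →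
      (+ (2 ^ mk k)) ∣ ((+ pbarK k n) - (+ (2 * k * (k + 1)))))
    × (¬ (∃ λ j → n ≡ j * j) → ¬ (∃ λ j → n ≡ 2 * (j * j)) →
      (+ (2 ^ mk k)) ∣ (+ pbarK k n))
theorem2p1 k _ n n≥1 =
  at-evenSquare k n n≥1 , at-oddSquare k n n≥1 , at-twiceSquare k n n≥1 , at-neither k n n≥1
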